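{- Every bad graph is equistarable.
   Context: Graphs are finite and simple. A chord of a cycle $C$ in $G$ is an edge of $G$ joining two vertices of $C$ that are non-consecutive on $C$. Given an odd cycle $C$ in $G$ and two disjoint edges $e,e'\in E(C)$, the graph $C-\{e,e'\}$ consists of two paths, exactly one of which, $P_0$, has even length; each end of $P_0$ is an endpoint of $e$ or of $e'$, and for $v\in V(P_0)$ let $d_{P_0}(v,e)$ (resp. $d_{P_0}(v,e')$) be the distance along $P_0$ from $v$ to the end of $P_0$ that is an endpoint of $e$ (resp. $e'$). An $(e,e')$-non-crossing even chord of $C$ is a chord of $C$ both of whose endpoints lie on $P_0$ and are at even distance on $P_0$. An $(e,e')$-crossing odd chord of $C$ is a chord of $C$ exactly one of whose endpoints, say $v$, lies on $P_0$, with $d_{P_0}(v,e)\equiv d_{P_0}(v,e')\equiv 1\pmod 2$. A graph $G$ of odd order $n$ is bad if it has a Hamiltonian cycle $C_n$ such that for every two disjoint edges $e,e'\in E(C_n)$, $G$ contains an $(e,e')$-non-crossing even chord of $C_n$ or an $(e,e')$-crossing odd chord of $C_n$. A star is a set $E(v)$ of all edges incident with a vertex $v$; it is maximal if not properly contained in another star. A graph $G=(V,E)$ without isolated vertices is equistarable if there is $\varphi:E\to\mathbb{R}_{>0}$ such that for every $F\subseteq E$, $F$ is a maximal star iff $\sum_{e\in F}\varphi(e)=1$. -}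

module Defs where

open import Data.Nat using (ℕ; zero; suc; _+_; _∸_; _≤_; _<_; _<ᵇ_; NonZero; ∣_-_∣)
open import Data.Nat.DivMod using (_%_; _mod_)
open import Data.Nat.Divisibility using (_∣_)
open import Data.Fin using (Fin; toℕ; _≟_)
open import Data.Bool using (Bool; true; false; _∧_; _∨_; if_then_else_)
open import Data.Product using (Σ; ∃; ∃-syntax; _×_; _,_)
open import Data.Sum using (_⊎_)
open import Relation.Nullary using (¬_)
open import Relation.Nullary.Decidable using (⌊_⌋)
open import Relation.Binary.PropositionalEquality using (_≡_; _≢_)
open import Function.Definitions using (Injective)
open import Data.Rational using (ℚ; 0ℚ; 1ℚ) renaming (_+_ to _+ℚ_; _<_ to _<ℚ_)

record Graph (n : ℕ) : Set where
  field
    adj    : Fin n → Fin n → Bool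
    sym    : ∀ i j → adj i j ≡ adj j i
    irrefl : ∀ i → adj i i ≡ false
open Graph public

Adj : ∀ {n} → Graph n → Fin n → Fin n → Set
Adj G i j = adj G i j ≡ true

NoIsolated : ∀ {n} → Graph n → Set
NoIsolated {n} G = ∀ (v : Fin n) → ∃[ u ] Adj G v u

-- An edge {i,j} is represented canonically by the pair
-- (i , j) with toℕ i < toℕ j.  A set of edges F ⊆ E(G) is represented
-- by a Boolean function; the edge {i,j} (i < j) belongs to F iff it is
-- an edge of G and F i j ≡ true.  (Values of F elsewhere are ignored.)

EdgeSet : ℕ → Set
EdgeSet n = Fin n → Fin n → Bool

_∈E[_]_ : ∀ {n} → Fin n × Fin n → Graph n → EdgeSet n → Set
(i , j) ∈E[ G ] F = (toℕ i < toℕ j) × Adj G i j × (F i j ≡ true)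

_⊆E[_]_ : ∀ {n} → EdgeSet n → Graph n → EdgeSet n → Set
F ⊆E[ G ] F' = ∀ i j → (i , j) ∈E[ G ] F → (i , j) ∈E[ G ] F'

_≐E[_]_ : ∀ {n} → EdgeSet n → Graph n → EdgeSet n → Set
F ≐E[ G ] F' = (F ⊆E[ G ] F') × (F' ⊆E[ G ] F)

star : ∀ {n} → Graph n → Fin n → EdgeSet n
star G v i j = adj G i j ∧ (⌊ i ≟ v ⌋ ∨ ⌊ j ≟ v ⌋)

IsStar : ∀ {n} → Graph n → EdgeSet n → Set
IsStar G F = ∃[ v ] (F ≐E[ G ] star G v)

MaximalStar : ∀ {n} → Graph n → EdgeSet n → Set
MaximalStar {n} G F =
  IsStar G F × (∀ (w : Fin n) → F ⊆E[ G ] star G w → star G w ⊆E[ G ] F)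

sumℚ : ∀ {n} → (Fin n → ℚ) → ℚ
sumℚ {zero}  f = 0ℚ
sumℚ {suc n} f = f Fin.zero +ℚ sumℚ (λ i → f (Fin.suc i))

-- φ i j is the weight of the edge {i,j} for toℕ i < toℕ j
weight : ∀ {n} → Graph n → (Fin n → Fin n → ℚ) → EdgeSet n → ℚ
weight G φ F =
  sumℚ (λ i → sumℚ (λ j →
    if (toℕ i <ᵇ toℕ j) ∧ adj G i j ∧ F i j then φ i j else 0ℚ))

Equistarable : ∀ {n} → Graph n → Set
Equistarable {n} G =
  NoIsolated G ×
  Σ (Fin n → Fin n → ℚ) λ φ →
    (∀ i j → toℕ i < toℕ j → Adj G i j → 0ℚ <ℚ φ i j) ×
    (∀ (F : EdgeSet n) →
       (MaximalStar G F → weight G φ F ≡ 1ℚ) ×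
       (weight G φ F ≡ 1ℚ → MaximalStar G F))

-- A Hamiltonian cycle is a bijection σ from
-- positions Fin n to vertices with σ p adjacent to σ (p+1 mod n), n ≥ 3.
-- Edge index a : Fin n denotes the cycle edge {σ a , σ (a+1 mod n)}.

module _ {n : ℕ} .{{_ : NonZero n}} where

  nxt : Fin n → Fin n
  nxt p = suc (toℕ p) mod n

  record HamCycle (G : Graph n) : Set where
    field
      σ     : Fin n → Fin n
      σ-inj : Injective _≡_ _≡_ σ
      σ-sur : ∀ v → ∃[ p ] σ p ≡ v
      n≥3   : 3 ≤ n
      cyc   : ∀ p → Adj G (σ p) (σ (nxt p))

  DisjointEdges : Fin n → Fin n → Set
  DisjointEdges a b =
    (a ≢ b) × (a ≢ nxt b) × (nxt a ≢ b) × (nxt a ≢ nxt b)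

  -- C - {e_a , e_b} consists of the path Q1 from position a+1 (endpoint
  -- of e_a) forward to b (endpoint of e_b), of length L1, and the path
  -- Q2 from position b+1 (endpoint of e_b) forward to a (endpoint of
  -- e_a), of length L2.
  L₁ L₂ : Fin n → Fin n → ℕ
  L₁ a b = (toℕ b + n ∸ toℕ (nxt a)) % n
  L₂ a b = (toℕ a + n ∸ toℕ (nxt b)) % n

  -- OnP0 a b q d d' : position q lies on P0 (the even path of
  -- C - {e_a , e_b}) with d_{P0}(σ q, e_a) = d and d_{P0}(σ q, e_b) = d'.
  OnP0 : Fin n → Fin n → Fin n → ℕ → ℕ → Set
  OnP0 a b q d d' =
    (2 ∣ L₁ a b × ∃[ k ] (k ≤ L₁ a b × (toℕ (nxt a) + k) mod n ≡ q
                           × d ≡ k × d' ≡ L₁ a b ∸ k))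
    ⊎
    (2 ∣ L₂ a b × ∃[ k ] (k ≤ L₂ a b × (toℕ (nxt b) + k) mod n ≡ q
                           × d' ≡ k × d ≡ L₂ a b ∸ k))

  IsChord : (G : Graph n) → HamCycle G → Fin n → Fin n → Set
  IsChord G C p q =
    Adj G (σ p) (σ q) × (p ≢ nxt q) × (q ≢ nxt p)
    where open HamCycle C

  NonCrossingEvenChord : (G : Graph n) → HamCycle G → Fin n → Fin n → Set
  NonCrossingEvenChord G C a b =
    ∃[ p ] ∃[ q ] (IsChord G C p q ×
      ∃[ dp ] ∃[ dp' ] ∃[ dq ] ∃[ dq' ]
        (OnP0 a b p dp dp' × OnP0 a b q dq dq' × 2 ∣ ∣ dp - dq ∣))

  CrossingOddChord : (G : Graph n) → HamCycle G → Fin n → Fin n → Set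
  CrossingOddChord G C a b =
    ∃[ p ] ∃[ q ] (IsChord G C p q ×
      (∃[ dp ] ∃[ dp' ] (OnP0 a b p dp dp' × ¬ (2 ∣ dp) × ¬ (2 ∣ dp'))) ×
      ¬ (∃[ dq ] ∃[ dq' ] OnP0 a b q dq dq'))

  Bad : Graph n → Set
  Bad G =
    ¬ (2 ∣ n) ×
    Σ (HamCycle G) λ C →
      ∀ a b → DisjointEdges a b →
        NonCrossingEvenChord G C a b ⊎ CrossingOddChord G C a b

-- Let C = σ 0, σ 1, …, σ (n - 1) be the Hamiltonian cycle of odd length n witnessing badness and
-- d the forward distance between positions on C. Give every edge a vector: a leading coordinate
-- that is 1 on cycle edges and 0 on chords, and one coordinate per chord g = {g₁, g₂}, equal to 2
-- on g itself and to -((-1)^d(p+1, g₁) + (-1)^d(p+1, g₂)) on the cycle edge at position p.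
-- Because n is odd, the signs of the two cycle edges at a vertex v add up to 2 at v and cancel at
-- every other vertex, so every star sums to (2, 0, …, 0). Conversely a set F summing to
-- (2, 0, …, 0) contains exactly two cycle edges, and a chord lies in F exactly when those two
-- edges give it the value 2. Two consecutive cycle edges then force F to be the star of their
-- common vertex; two disjoint ones are impossible, because badness provides a chord getting ±4
-- (a non-crossing even chord) or -2 (a crossing odd chord). Reading the vectors as numerals in a
-- large base gives positive integer weights, and dividing by the value of a star gives φ.

module Submission where

open import Data.Nat as ℕ using (ℕ; zero; suc; NonZero; z≤n; s≤s)
import Data.Nat.Properties as ℕP
open import Data.Nat.Divisibility using (_∣_)
open import Data.Integer as ℤ using (ℤ; 0ℤ; 1ℤ; -1ℤ)
import Data.Integer.Properties as ℤP
open import Data.Fin using (Fin; zero; suc; toℕ; _≟_)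
open import Data.Fin.Properties using (suc-injective; toℕ-injective)
open import Data.Product using (∃-syntax; _×_; _,_; proj₁; proj₂; uncurry)
open import Data.Sum using (_⊎_; inj₁; inj₂; [_,_])
import Data.Sum
open import Data.Empty using (⊥-elim)
open import Function using (_∘_; case_of_)
open import Relation.Nullary using (¬_; Dec; yes; no)
open import Relation.Binary.PropositionalEquality hiding ([_])
open import Algebra.Bundles using (AbelianGroup)
open import Algebra.Properties.CommutativeMonoid.Sum ℤP.+-0-commutativeMonoid
  using (sum; sum-cong-≗; sum-replicate-zero; ∑-distrib-+)

open import Defs hiding (sym)

module IntegerSums where

  open import Data.Integer using (_+_; _*_; ∣_∣)
  open import Data.Fin using (_↑ˡ_; _↑ʳ_; combine; remQuot)
  open import Data.Fin.Properties using (remQuot-combine; combine-remQuot)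
  open import Algebra.Properties.Group (AbelianGroup.group ℤP.+-0-abelianGroup) using (∙-cancelˡ)

  sum-zero : ∀ {m} {f : Fin m → ℤ} → (∀ i → f i ≡ 0ℤ) → sum f ≡ 0ℤ
  sum-zero {m} f≡0 = trans (sum-cong-≗ f≡0) (sum-replicate-zero m)

  sum-*ˡ : ∀ {m} c (f : Fin m → ℤ) → sum (λ i → c * f i) ≡ c * sum f
  sum-*ˡ {zero}  c f = sym (ℤP.*-zeroʳ c)
  sum-*ˡ {suc m} c f = trans (cong ((c * f zero) +_) (sum-*ˡ c (f ∘ suc)))
                             (sym (ℤP.*-distribˡ-+ c (f zero) _))

  sum-support₁ : ∀ {m} (f : Fin m → ℤ) x → (∀ i → i ≢ x → f i ≡ 0ℤ) → sum f ≡ f x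
  sum-support₁ f zero    f≡0 =
    trans (cong (f zero +_) (sum-zero (λ i → f≡0 (suc i) λ ()))) (ℤP.+-identityʳ _)
  sum-support₁ f (suc x) f≡0 =
    trans (cong₂ _+_ (f≡0 zero λ ()) (sum-support₁ (f ∘ suc) x (λ i i≢x → f≡0 (suc i) (i≢x ∘ suc-injective))))
          (ℤP.+-identityˡ _)

  sum-support₂ : ∀ {m} (f : Fin m → ℤ) x y → x ≢ y →
                 (∀ i → i ≢ x → i ≢ y → f i ≡ 0ℤ) → sum f ≡ f x + f y
  sum-support₂ f zero    zero    x≢y _   = ⊥-elim (x≢y refl)
  sum-support₂ f zero    (suc y) _   f≡0 =
    cong (f zero +_) (sum-support₁ (f ∘ suc) y (λ i i≢y → f≡0 (suc i) (λ ()) (i≢y ∘ suc-injective)))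
  sum-support₂ f (suc x) zero    _   f≡0 =
    trans (cong (f zero +_) (sum-support₁ (f ∘ suc) x (λ i i≢x → f≡0 (suc i) (i≢x ∘ suc-injective) (λ ()))))
          (ℤP.+-comm (f zero) _)
  sum-support₂ f (suc x) (suc y) x≢y f≡0 =
    trans (cong₂ _+_ (f≡0 zero (λ ()) (λ ()))
                     (sum-support₂ (f ∘ suc) x y (x≢y ∘ cong suc)
                        (λ i i≢x i≢y → f≡0 (suc i) (i≢x ∘ suc-injective) (i≢y ∘ suc-injective))))
          (ℤP.+-identityˡ _)

  sum-nonneg : ∀ {m} (f : Fin m → ℤ) → (∀ i → 0ℤ ℤ.≤ f i) → 0ℤ ℤ.≤ sum f
  sum-nonneg {zero}  f f≥0 = ℤP.≤-refl
  sum-nonneg {suc m} f f≥0 = ℤP.+-mono-≤ (f≥0 zero) (sum-nonneg (f ∘ suc) (f≥0 ∘ suc))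

  private
    nonneg+nonneg≡0 : ∀ {a b} → 0ℤ ℤ.≤ a → 0ℤ ℤ.≤ b → a + b ≡ 0ℤ → a ≡ 0ℤ × b ≡ 0ℤ
    nonneg+nonneg≡0 (ℤ.+≤+ {n = m} _) (ℤ.+≤+ {n = k} _) m+k≡0 =
      cong ℤ.+_ (ℕP.m+n≡0⇒m≡0 m (ℤP.+-injective m+k≡0)) , cong ℤ.+_ (ℕP.m+n≡0⇒n≡0 m (ℤP.+-injective m+k≡0))

  sum-nonneg≡0 : ∀ {m} (f : Fin m → ℤ) → (∀ i → 0ℤ ℤ.≤ f i) → sum f ≡ 0ℤ → ∀ i → f i ≡ 0ℤ
  sum-nonneg≡0 f f≥0 Σf≡0 zero    =
    proj₁ (nonneg+nonneg≡0 (f≥0 zero) (sum-nonneg (f ∘ suc) (f≥0 ∘ suc)) Σf≡0)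
  sum-nonneg≡0 f f≥0 Σf≡0 (suc i) = sum-nonneg≡0 (f ∘ suc) (f≥0 ∘ suc)
    (proj₂ (nonneg+nonneg≡0 (f≥0 zero) (sum-nonneg (f ∘ suc) (f≥0 ∘ suc)) Σf≡0)) i

  sum-bound : ∀ {m} (f : Fin m → ℤ) K → (∀ i → ∣ f i ∣ ℕ.≤ K) → ∣ sum f ∣ ℕ.≤ m ℕ.* K
  sum-bound {zero}  f K _  = ℕ.z≤n
  sum-bound {suc m} f K ∣f∣≤K = ℕP.≤-trans (ℤP.∣i+j∣≤∣i∣+∣j∣ (f zero) _)
    (ℕP.+-mono-≤ (∣f∣≤K zero) (sum-bound (f ∘ suc) K (∣f∣≤K ∘ suc)))

  Bit : ℤ → Set
  Bit z = z ≡ 0ℤ ⊎ z ≡ 1ℤ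

  private
    bit-nonneg : ∀ {z} → Bit z → 0ℤ ℤ.≤ z
    bit-nonneg (inj₁ refl) = ℤP.≤-refl
    bit-nonneg (inj₂ refl) = ℤ.+≤+ ℕ.z≤n

    1+x≡1⇒x≡0 : ∀ {x} → 1ℤ + x ≡ 1ℤ → x ≡ 0ℤ
    1+x≡1⇒x≡0 eq = ∙-cancelˡ 1ℤ _ _ (trans eq (sym (ℤP.+-identityʳ 1ℤ)))

    1+x≡2⇒x≡1 : ∀ {x} → 1ℤ + x ≡ ℤ.+ 2 → x ≡ 1ℤ
    1+x≡2⇒x≡1 eq = ∙-cancelˡ 1ℤ _ _ eq

  sum-bits≡1 : ∀ {m} (f : Fin m → ℤ) → (∀ i → Bit (f i)) → sum f ≡ 1ℤ →
               ∃[ x ] (f x ≡ 1ℤ × ∀ i → i ≢ x → f i ≡ 0ℤ)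
  sum-bits≡1 {suc m} f bits Σf≡1 with bits zero
  ... | inj₁ f₀≡0 with sum-bits≡1 (f ∘ suc) (bits ∘ suc)
                         (trans (sym (ℤP.+-identityˡ _)) (trans (cong (_+ sum (f ∘ suc)) (sym f₀≡0)) Σf≡1))
  ...   | x , fx≡1 , rest = suc x , fx≡1 , λ { zero _ → f₀≡0 ; (suc i) i≢x → rest i (i≢x ∘ cong suc) }
  sum-bits≡1 {suc m} f bits Σf≡1 | inj₂ f₀≡1 = zero , f₀≡1 , λ
    { zero 0≢0 → ⊥-elim (0≢0 refl)
    ; (suc i) _ → sum-nonneg≡0 (f ∘ suc) (bit-nonneg ∘ bits ∘ suc)
                    (1+x≡1⇒x≡0 (trans (cong (_+ sum (f ∘ suc)) (sym f₀≡1)) Σf≡1)) i }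

  sum-bits≡2 : ∀ {m} (f : Fin m → ℤ) → (∀ i → Bit (f i)) → sum f ≡ ℤ.+ 2 →
               ∃[ x ] ∃[ y ] (x ≢ y × f x ≡ 1ℤ × f y ≡ 1ℤ × ∀ i → i ≢ x → i ≢ y → f i ≡ 0ℤ)
  sum-bits≡2 {suc m} f bits Σf≡2 with bits zero
  ... | inj₁ f₀≡0 with sum-bits≡2 (f ∘ suc) (bits ∘ suc)
                         (trans (sym (ℤP.+-identityˡ _)) (trans (cong (_+ sum (f ∘ suc)) (sym f₀≡0)) Σf≡2))
  ...   | x , y , x≢y , fx≡1 , fy≡1 , rest = suc x , suc y , x≢y ∘ suc-injective , fx≡1 , fy≡1 ,
          λ { zero _ _ → f₀≡0 ; (suc i) i≢x i≢y → rest i (i≢x ∘ cong suc) (i≢y ∘ cong suc) }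
  sum-bits≡2 {suc m} f bits Σf≡2 | inj₂ f₀≡1 with sum-bits≡1 (f ∘ suc) (bits ∘ suc)
                                                  (1+x≡2⇒x≡1 (trans (cong (_+ sum (f ∘ suc)) (sym f₀≡1)) Σf≡2))
  ... | y , fy≡1 , rest = zero , suc y , (λ ()) , f₀≡1 , fy≡1 , λ
    { zero 0≢0 _ → ⊥-elim (0≢0 refl)
    ; (suc i) _ i≢y → rest i (i≢y ∘ cong suc) }

  private
    sum-splitAt : ∀ k {l} (f : Fin (k ℕ.+ l) → ℤ) →
                  sum f ≡ sum (λ i → f (i ↑ˡ l)) + sum (λ i → f (k ↑ʳ i))
    sum-splitAt zero    f = sym (ℤP.+-identityˡ (sum f))
    sum-splitAt (suc k) f = trans (cong (f zero +_) (sum-splitAt k (f ∘ suc))) (sym (ℤP.+-assoc (f zero) _ _))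

  ∑∑ : ∀ {m k} → (Fin m → Fin k → ℤ) → ℤ
  ∑∑ f = sum (λ i → sum (f i))

  ∑∑-cong : ∀ {m k} {f g : Fin m → Fin k → ℤ} → (∀ i j → f i j ≡ g i j) → ∑∑ f ≡ ∑∑ g
  ∑∑-cong f≡g = sum-cong-≗ (λ i → sum-cong-≗ (f≡g i))

  ∑∑-zero : ∀ {m k} {f : Fin m → Fin k → ℤ} → (∀ i j → f i j ≡ 0ℤ) → ∑∑ f ≡ 0ℤ
  ∑∑-zero f≡0 = sum-zero (λ i → sum-zero (f≡0 i))

  ∑∑-distrib-+ : ∀ {m k} (f g : Fin m → Fin k → ℤ) → ∑∑ (λ i j → f i j + g i j) ≡ ∑∑ f + ∑∑ g
  ∑∑-distrib-+ f g =
    trans (sum-cong-≗ (λ i → ∑-distrib-+ (f i) (g i))) (∑-distrib-+ (λ i → sum (f i)) (λ i → sum (g i)))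

  ∑∑-combine : ∀ {m k} (h : Fin (m ℕ.* k) → ℤ) → ∑∑ {m} {k} (λ i j → h (combine i j)) ≡ sum h
  ∑∑-combine {zero}      h = refl
  ∑∑-combine {suc m} {k} h =
    trans (cong (sum (λ j → h (j ↑ˡ m ℕ.* k)) +_) (∑∑-combine {m} {k} (λ p → h (k ↑ʳ p)))) (sym (sum-splitAt k h))

  ∑∑-as-sum : ∀ {m k} (f : Fin m → Fin k → ℤ) → ∑∑ f ≡ sum (λ p → uncurry f (remQuot {m} k p))
  ∑∑-as-sum {m} {k} f =
    trans (∑∑-cong {m} {k} (λ i j → cong (uncurry f) (sym (remQuot-combine i j)))) (∑∑-combine {m} {k} _)

  ∑∑-*ˡ : ∀ {m k} c (f : Fin m → Fin k → ℤ) → ∑∑ (λ i j → c * f i j) ≡ c * ∑∑ f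
  ∑∑-*ˡ c f = trans (sum-cong-≗ (λ i → sum-*ˡ c (f i))) (sum-*ˡ c (λ i → sum (f i)))

  ∑∑-support₁ : ∀ {m k} (f : Fin m → Fin k → ℤ) x → (∀ i j → (i , j) ≢ x → f i j ≡ 0ℤ) →
                ∑∑ f ≡ uncurry f x
  ∑∑-support₁ f (x₁ , x₂) f≡0 =
    trans (sum-support₁ _ x₁ (λ i i≢x₁ → sum-zero (λ j → f≡0 i j (i≢x₁ ∘ cong proj₁))))
          (sum-support₁ (f x₁) x₂ (λ j j≢x₂ → f≡0 x₁ j (j≢x₂ ∘ cong proj₂)))

  ∑∑-support₂ : ∀ {m k} (f : Fin m → Fin k → ℤ) x y → x ≢ y →
                (∀ i j → (i , j) ≢ x → (i , j) ≢ y → f i j ≡ 0ℤ) → ∑∑ f ≡ uncurry f x + uncurry f y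
  ∑∑-support₂ f (x₁ , x₂) (y₁ , y₂) x≢y f≡0 with x₁ ≟ y₁
  ... | yes refl =
    trans (sum-support₁ _ x₁ (λ i i≢x₁ → sum-zero (λ j → f≡0 i j (i≢x₁ ∘ cong proj₁) (i≢x₁ ∘ cong proj₁))))
          (sum-support₂ (f x₁) x₂ y₂ (x≢y ∘ cong (x₁ ,_))
             (λ j j≢x₂ j≢y₂ → f≡0 x₁ j (j≢x₂ ∘ cong proj₂) (j≢y₂ ∘ cong proj₂)))
  ... | no x₁≢y₁ =
    trans (sum-support₂ _ x₁ y₁ x₁≢y₁
             (λ i i≢x₁ i≢y₁ → sum-zero (λ j → f≡0 i j (i≢x₁ ∘ cong proj₁) (i≢y₁ ∘ cong proj₁))))
          (cong₂ _+_ (sum-support₁ (f x₁) x₂ (λ j j≢x₂ → f≡0 x₁ j (j≢x₂ ∘ cong proj₂) (x₁≢y₁ ∘ cong proj₁)))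
                     (sum-support₁ (f y₁) y₂ (λ j j≢y₂ → f≡0 y₁ j (x₁≢y₁ ∘ sym ∘ cong proj₁) (j≢y₂ ∘ cong proj₂))))

  ∑∑-bits≡2 : ∀ {m k} (f : Fin m → Fin k → ℤ) → (∀ i j → Bit (f i j)) → ∑∑ f ≡ ℤ.+ 2 →
              ∃[ x ] ∃[ y ] (x ≢ y × uncurry f x ≡ 1ℤ × uncurry f y ≡ 1ℤ ×
                             ∀ i j → (i , j) ≢ x → (i , j) ≢ y → f i j ≡ 0ℤ)
  ∑∑-bits≡2 {m} {k} f bits Σf≡2
    with sum-bits≡2 g (λ p → uncurry bits (remQuot k p))
           (trans (sym (∑∑-as-sum f)) Σf≡2)
    where g = λ p → uncurry f (remQuot {m} k p)
  ... | p , q , p≢q , fp≡1 , fq≡1 , rest =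
    remQuot k p , remQuot k q , p≢q ∘ remQuot-injective , fp≡1 , fq≡1 , λ i j ij≢p ij≢q →
      subst (λ x → uncurry f x ≡ 0ℤ) (remQuot-combine i j)
        (rest (combine i j) (ij≢p ∘ via-remQuot) (ij≢q ∘ via-remQuot))
    where
    remQuot-injective : ∀ {p q} → remQuot {m} k p ≡ remQuot k q → p ≡ q
    remQuot-injective {p} {q} eq =
      trans (sym (combine-remQuot {m} k p)) (trans (cong (uncurry combine) eq) (combine-remQuot {m} k q))
    via-remQuot : ∀ {i j p} → combine i j ≡ p → (i , j) ≡ remQuot k p
    via-remQuot {i} {j} refl = sym (remQuot-combine i j)

  ∑∑-bound : ∀ {m k} (f : Fin m → Fin k → ℤ) K → (∀ i j → ∣ f i j ∣ ℕ.≤ K) →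
             ∣ ∑∑ f ∣ ℕ.≤ m ℕ.* (k ℕ.* K)
  ∑∑-bound {k = k} f K ∣f∣≤K = sum-bound _ (k ℕ.* K) (λ i → sum-bound (f i) K (∣f∣≤K i))


module Signs where

  open import Data.Integer using (_*_; -_; _^_)

  open import Data.Nat.Divisibility using (_∣0; ∣1⇒≡1; ∣-refl; ∣m∣n⇒∣m+n; ∣m+n∣m⇒∣n)

  -1*-1*i≡i : ∀ i → -1ℤ * (-1ℤ * i) ≡ i
  -1*-1*i≡i i = trans (ℤP.-1*i≡-i _) (trans (cong -_ (ℤP.-1*i≡-i i)) (ℤP.neg-involutive i))

  -1^-parity : ∀ k → (2 ∣ k × -1ℤ ^ k ≡ 1ℤ) ⊎ (¬ 2 ∣ k × -1ℤ ^ k ≡ -1ℤ)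
  -1^-parity zero          = inj₁ (2 ∣0 , refl)
  -1^-parity (suc zero)    = inj₂ ((λ 2∣1 → case ∣1⇒≡1 2∣1 of λ ()) , refl)
  -1^-parity (suc (suc k)) with -1^-parity k
  ... | inj₁ (2∣k , ±1) = inj₁ (∣m∣n⇒∣m+n ∣-refl 2∣k , trans (-1*-1*i≡i (-1ℤ ^ k)) ±1)
  ... | inj₂ (2∤k , ±1) = inj₂ (2∤k ∘ (λ 2∣2+k → ∣m+n∣m⇒∣n 2∣2+k ∣-refl) , trans (-1*-1*i≡i (-1ℤ ^ k)) ±1)

  -1^even≡1 : ∀ {k} → 2 ∣ k → -1ℤ ^ k ≡ 1ℤ
  -1^even≡1 {k} 2∣k with -1^-parity k
  ... | inj₁ (_ , ±1) = ±1
  ... | inj₂ (2∤k , _) = ⊥-elim (2∤k 2∣k)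

  -1^odd≡-1 : ∀ {k} → ¬ 2 ∣ k → -1ℤ ^ k ≡ -1ℤ
  -1^odd≡-1 {k} 2∤k with -1^-parity k
  ... | inj₁ (2∣k , _) = ⊥-elim (2∤k 2∣k)
  ... | inj₂ (_ , ±1) = ±1

  -1^≡±1 : ∀ k → -1ℤ ^ k ≡ 1ℤ ⊎ -1ℤ ^ k ≡ -1ℤ
  -1^≡±1 k with -1^-parity k
  ... | inj₁ (_ , ±1) = inj₁ ±1
  ... | inj₂ (_ , ±1) = inj₂ ±1

  -1^-square : ∀ k → -1ℤ ^ k * -1ℤ ^ k ≡ 1ℤ
  -1^-square k with -1^≡±1 k
  ... | inj₁ ±1 rewrite ±1 = refl
  ... | inj₂ ±1 rewrite ±1 = refl

  -1^-+ : ∀ a b → -1ℤ ^ (a ℕ.+ b) ≡ -1ℤ ^ a * -1ℤ ^ b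
  -1^-+ = ℤP.^-distribˡ-+-* -1ℤ

  -1^-∸ : ∀ {a b} → a ℕ.≤ b → -1ℤ ^ (b ℕ.∸ a) ≡ -1ℤ ^ b * -1ℤ ^ a
  -1^-∸ {a} {b} a≤b = begin
    -1ℤ ^ (b ℕ.∸ a)                             ≡⟨ sym (ℤP.*-identityʳ _) ⟩
    -1ℤ ^ (b ℕ.∸ a) * 1ℤ                        ≡⟨ cong (-1ℤ ^ (b ℕ.∸ a) *_) (sym (-1^-square a)) ⟩
    -1ℤ ^ (b ℕ.∸ a) * (-1ℤ ^ a * -1ℤ ^ a)       ≡⟨ sym (ℤP.*-assoc (-1ℤ ^ (b ℕ.∸ a)) _ _) ⟩
    -1ℤ ^ (b ℕ.∸ a) * -1ℤ ^ a * -1ℤ ^ a         ≡⟨ cong (_* -1ℤ ^ a) (sym (-1^-+ (b ℕ.∸ a) a)) ⟩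
    -1ℤ ^ (b ℕ.∸ a ℕ.+ a) * -1ℤ ^ a             ≡⟨ cong (λ c → -1ℤ ^ c * -1ℤ ^ a) (ℕP.m∸n+n≡m a≤b) ⟩
    -1ℤ ^ b * -1ℤ ^ a                           ∎
    where open ≡-Reasoning

  -1^-even-gap : ∀ {x y} → x ℕ.≤ y → 2 ∣ y ℕ.∸ x → -1ℤ ^ y ≡ -1ℤ ^ x
  -1^-even-gap {x} {y} x≤y 2∣y-x = begin
    -1ℤ ^ y                         ≡⟨ cong (-1ℤ ^_) (sym (ℕP.m+[n∸m]≡n x≤y)) ⟩
    -1ℤ ^ (x ℕ.+ (y ℕ.∸ x))         ≡⟨ -1^-+ x (y ℕ.∸ x) ⟩
    -1ℤ ^ x * -1ℤ ^ (y ℕ.∸ x)       ≡⟨ cong (-1ℤ ^ x *_) (-1^even≡1 2∣y-x) ⟩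
    -1ℤ ^ x * 1ℤ                    ≡⟨ ℤP.*-identityʳ _ ⟩
    -1ℤ ^ x                         ∎
    where open ≡-Reasoning

  -1^-cong-parity : ∀ a b → 2 ∣ ℕ.∣ a - b ∣ → -1ℤ ^ a ≡ -1ℤ ^ b
  -1^-cong-parity a b 2∣a-b with ℕP.≤-total a b
  ... | inj₁ a≤b = sym (-1^-even-gap a≤b (subst (2 ∣_) (ℕP.m≤n⇒∣m-n∣≡n∸m a≤b) 2∣a-b))
  ... | inj₂ b≤a = -1^-even-gap b≤a (subst (2 ∣_) (trans (ℕP.∣-∣-comm a b) (ℕP.m≤n⇒∣m-n∣≡n∸m b≤a)) 2∣a-b)

  -1^-complement : ∀ {a b c} → a ℕ.+ b ≡ c → -1ℤ ^ c ≡ 1ℤ → -1ℤ ^ b ≡ -1ℤ ^ a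
  -1^-complement {a} {b} {c} a+b≡c -1^c≡1 = begin
    -1ℤ ^ b                            ≡⟨ sym (ℤP.*-identityˡ _) ⟩
    1ℤ * -1ℤ ^ b                       ≡⟨ cong (_* -1ℤ ^ b) (sym (-1^-square a)) ⟩
    -1ℤ ^ a * -1ℤ ^ a * -1ℤ ^ b        ≡⟨ ℤP.*-assoc (-1ℤ ^ a) _ _ ⟩
    -1ℤ ^ a * (-1ℤ ^ a * -1ℤ ^ b)      ≡⟨ cong (-1ℤ ^ a *_) (sym (-1^-+ a b)) ⟩
    -1ℤ ^ a * -1ℤ ^ (a ℕ.+ b)          ≡⟨ cong (λ k → -1ℤ ^ a * -1ℤ ^ k) a+b≡c ⟩
    -1ℤ ^ a * -1ℤ ^ c                  ≡⟨ cong (-1ℤ ^ a *_) -1^c≡1 ⟩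
    -1ℤ ^ a * 1ℤ                       ≡⟨ ℤP.*-identityʳ _ ⟩
    -1ℤ ^ a                            ∎
    where open ≡-Reasoning

module PositionalNotation where

  open IntegerSums
  open import Data.Nat using (_^_)
  open import Data.Integer using (_+_; _*_; -_; _-_; ∣_∣)
  open import Data.Integer.Tactic.RingSolver using (solve-∀)
  open import Algebra.Properties.Group (AbelianGroup.group ℤP.+-0-abelianGroup) using (inverseʳ-unique)

  fromDigits : ℕ → ∀ {m} → (Fin m → ℤ) → ℤ
  fromDigits B {zero}  e = 0ℤ
  fromDigits B {suc m} e = e zero + ℤ.+ B * fromDigits B (e ∘ suc)

  module _ (B : ℕ) where

    fromDigits-cong : ∀ {m} {e e' : Fin m → ℤ} → (∀ j → e j ≡ e' j) → fromDigits B e ≡ fromDigits B e'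
    fromDigits-cong {zero}  e≡e' = refl
    fromDigits-cong {suc m} e≡e' = cong₂ (λ d r → d + ℤ.+ B * r) (e≡e' zero) (fromDigits-cong (e≡e' ∘ suc))

    fromDigits-zero : ∀ {m} {e : Fin m → ℤ} → (∀ j → e j ≡ 0ℤ) → fromDigits B e ≡ 0ℤ
    fromDigits-zero {zero}  e≡0 = refl
    fromDigits-zero {suc m} e≡0 =
      trans (cong₂ (λ d r → d + ℤ.+ B * r) (e≡0 zero) (fromDigits-zero (e≡0 ∘ suc)))
            (trans (ℤP.+-identityˡ _) (ℤP.*-zeroʳ (ℤ.+ B)))

    fromDigits-+ : ∀ {m} (e e' : Fin m → ℤ) → fromDigits B (λ j → e j + e' j) ≡ fromDigits B e + fromDigits B e'
    fromDigits-+ {zero}  e e' = refl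
    fromDigits-+ {suc m} e e' rewrite fromDigits-+ (e ∘ suc) (e' ∘ suc) =
      interchange (e zero) (e' zero) (ℤ.+ B) (fromDigits B (e ∘ suc)) (fromDigits B (e' ∘ suc))
      where
      interchange : ∀ a b c x y → a + b + c * (x + y) ≡ a + c * x + (b + c * y)
      interchange = solve-∀

    fromDigits-sum : ∀ {k m} (e : Fin k → Fin m → ℤ) →
                     fromDigits B (λ j → sum (λ x → e x j)) ≡ sum (λ x → fromDigits B (e x))
    fromDigits-sum {zero} {m} e = fromDigits-zero {m} (λ _ → refl)
    fromDigits-sum {suc k} e =
      trans (fromDigits-+ (e zero) (λ j → sum (λ x → e (suc x) j)))
            (cong (fromDigits B (e zero) +_) (fromDigits-sum (e ∘ suc)))

    fromDigits-nonneg : ∀ {m} (e : Fin m → ℤ) → (∀ j → 0ℤ ℤ.≤ e j) → 0ℤ ℤ.≤ fromDigits B e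
    fromDigits-nonneg {zero}  e e≥0 = ℤP.≤-refl
    fromDigits-nonneg {suc m} e e≥0 =
      ℤP.+-mono-≤ (e≥0 zero) (ℤP.≤-trans (ℤP.≤-reflexive (sym (ℤP.*-zeroʳ (ℤ.+ B))))
                                         (ℤP.*-monoˡ-≤-nonNeg (ℤ.+ B) (fromDigits-nonneg (e ∘ suc) (e≥0 ∘ suc))))

    fromDigits-∑∑ : ∀ {k l m} (e : Fin k → Fin l → Fin m → ℤ) →
                    fromDigits B (λ j → ∑∑ (λ x y → e x y j)) ≡ ∑∑ (λ x y → fromDigits B (e x y))
    fromDigits-∑∑ e = trans (fromDigits-sum (λ x j → sum (λ y → e x y j))) (sum-cong-≗ (λ x → fromDigits-sum (e x)))

    ∣fromDigits∣< : ∀ {m} (e : Fin m → ℤ) → (∀ j → ∣ e j ∣ ℕ.< B) → ∣ fromDigits B e ∣ ℕ.< B ^ m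
    ∣fromDigits∣< {zero}  e ∣e∣<B = ℕP.≤-refl
    ∣fromDigits∣< {suc m} e ∣e∣<B = begin-strict
      ∣ e zero + ℤ.+ B * r ∣        ≤⟨ ℤP.∣i+j∣≤∣i∣+∣j∣ (e zero) _ ⟩
      ∣ e zero ∣ ℕ.+ ∣ ℤ.+ B * r ∣  ≡⟨ cong (∣ e zero ∣ ℕ.+_) (ℤP.abs-* (ℤ.+ B) r) ⟩
      ∣ e zero ∣ ℕ.+ B ℕ.* ∣ r ∣    <⟨ ℕP.+-monoˡ-< _ (∣e∣<B zero) ⟩
      B ℕ.+ B ℕ.* ∣ r ∣             ≡⟨ sym (ℕP.*-suc B ∣ r ∣) ⟩
      B ℕ.* suc ∣ r ∣               ≤⟨ ℕP.*-monoʳ-≤ B (∣fromDigits∣< (e ∘ suc) (∣e∣<B ∘ suc)) ⟩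
      B ℕ.* B ^ m                   ∎
      where
      open ℕP.≤-Reasoning
      r = fromDigits B (e ∘ suc)

  small+B*x≡0 : ∀ {B a x} → ∣ a ∣ ℕ.< B → a + ℤ.+ B * x ≡ 0ℤ → a ≡ 0ℤ × x ≡ 0ℤ
  small+B*x≡0 {B} {a} {x} ∣a∣<B a+Bx≡0 with x ℤ.≟ 0ℤ
  ... | yes refl = trans (sym (a+B*0≡a a)) a+Bx≡0 , refl
    where
    a+B*0≡a : ∀ a → a + ℤ.+ B * 0ℤ ≡ a
    a+B*0≡a a = trans (cong (a +_) (ℤP.*-zeroʳ (ℤ.+ B))) (ℤP.+-identityʳ a)
  ... | no  x≢0 = ⊥-elim (ℕP.<⇒≱ ∣a∣<B (begin
    B                    ≡⟨ sym (ℕP.*-identityʳ B) ⟩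
    B ℕ.* 1              ≤⟨ ℕP.*-monoʳ-≤ B (ℕP.n≢0⇒n>0 (x≢0 ∘ ℤP.∣i∣≡0⇒i≡0)) ⟩
    B ℕ.* ∣ x ∣          ≡⟨ sym (ℤP.abs-* (ℤ.+ B) x) ⟩
    ∣ ℤ.+ B * x ∣        ≡⟨ cong ∣_∣ (inverseʳ-unique a _ a+Bx≡0) ⟩
    ∣ - a ∣              ≡⟨ ℤP.∣-i∣≡∣i∣ a ⟩
    ∣ a ∣                ∎))
    where open ℕP.≤-Reasoning

  fromDigits≡0 : ∀ B {m} (e : Fin m → ℤ) → (∀ j → ∣ e j ∣ ℕ.< B) → fromDigits B e ≡ 0ℤ → ∀ j → e j ≡ 0ℤ
  fromDigits≡0 B e ∣e∣<B Σ≡0 zero    = proj₁ (small+B*x≡0 {a = e zero} (∣e∣<B zero) Σ≡0)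
  fromDigits≡0 B e ∣e∣<B Σ≡0 (suc j) =
    fromDigits≡0 B (e ∘ suc) (∣e∣<B ∘ suc) (proj₂ (small+B*x≡0 {a = e zero} (∣e∣<B zero) Σ≡0)) j

  ∣i∣<k⇒0<i+k : ∀ i k → ∣ i ∣ ℕ.< k → 0ℤ ℤ.< i + ℤ.+ k
  ∣i∣<k⇒0<i+k i k ∣i∣<k = ℤP.≤-<-trans (ℤP.≤-reflexive (sym (ℤP.+-inverseʳ i)))
                            (ℤP.+-monoʳ-< i (ℤP.≤-<-trans (-i≤∣i∣ i) (ℤ.+<+ ∣i∣<k)))
    where
    -i≤∣i∣ : ∀ i → - i ℤ.≤ ℤ.+ ∣ i ∣
    -i≤∣i∣ (ℤ.+ m)    = ℤP.neg-≤-pos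
    -i≤∣i∣ ℤ.-[1+ m ] = ℤP.≤-refl

  module MatrixEncoding (B n : ℕ) where

    K : ℕ
    K = (B ^ n) ^ n

    rows : (Fin n → Fin n → ℤ) → ℤ
    rows e = fromDigits (B ^ n) (λ i → fromDigits B (e i))

    encode : (Fin n → Fin n → ℤ) → ℤ → ℤ
    encode e t = rows e + ℤ.+ K * t

    encode-cong : ∀ {e e' t t'} → (∀ i j → e i j ≡ e' i j) → t ≡ t' → encode e t ≡ encode e' t'
    encode-cong e≡e' t≡t' =
      cong₂ (λ r t → r + ℤ.+ K * t) (fromDigits-cong (B ^ n) (λ i → fromDigits-cong B (e≡e' i))) t≡t'

    encode-∑∑ : ∀ {k l} (e : Fin k → Fin l → Fin n → Fin n → ℤ) (t : Fin k → Fin l → ℤ) →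
                ∑∑ (λ x y → encode (e x y) (t x y)) ≡ encode (λ i j → ∑∑ (λ x y → e x y i j)) (∑∑ t)
    encode-∑∑ e t = begin
      ∑∑ (λ x y → encode (e x y) (t x y))
        ≡⟨ ∑∑-distrib-+ (λ x y → fromDigits (B ^ n) (λ i → fromDigits B (e x y i))) (λ x y → ℤ.+ K * t x y) ⟩
      ∑∑ (λ x y → fromDigits (B ^ n) (λ i → fromDigits B (e x y i))) + ∑∑ (λ x y → ℤ.+ K * t x y)
        ≡⟨ cong₂ _+_ (sym (fromDigits-∑∑ (B ^ n) (λ x y i → fromDigits B (e x y i)))) (∑∑-*ˡ (ℤ.+ K) t) ⟩
      fromDigits (B ^ n) (λ i → ∑∑ (λ x y → fromDigits B (e x y i))) + ℤ.+ K * ∑∑ t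
        ≡⟨ cong (_+ ℤ.+ K * ∑∑ t) (fromDigits-cong (B ^ n) (λ i → sym (fromDigits-∑∑ B (λ x y → e x y i)))) ⟩
      encode (λ i j → ∑∑ (λ x y → e x y i j)) (∑∑ t) ∎
      where open ≡-Reasoning

    private
      ∣rows∣<K : ∀ e → (∀ i j → ∣ e i j ∣ ℕ.< B) → ∣ rows e ∣ ℕ.< K
      ∣rows∣<K e ∣e∣<B = ∣fromDigits∣< (B ^ n) (λ i → fromDigits B (e i)) (λ i → ∣fromDigits∣< B (e i) (∣e∣<B i))

    encode≡0 : ∀ e t → (∀ i j → ∣ e i j ∣ ℕ.< B) → encode e t ≡ 0ℤ → t ≡ 0ℤ × ∀ i j → e i j ≡ 0ℤ
    encode≡0 e t ∣e∣<B e,t≡0 =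
      let rows≡0 , t≡0 = small+B*x≡0 (∣rows∣<K e ∣e∣<B) e,t≡0
          row≡0 = fromDigits≡0 (B ^ n) (λ i → fromDigits B (e i)) (λ i → ∣fromDigits∣< B (e i) (∣e∣<B i)) rows≡0
      in t≡0 , λ i → fromDigits≡0 B (e i) (∣e∣<B i) (row≡0 i)

    encode-lead : ∀ t → encode (λ _ _ → 0ℤ) t ≡ ℤ.+ K * t
    encode-lead t = trans (cong (_+ ℤ.+ K * t) (fromDigits-zero (B ^ n) {n} (λ i → fromDigits-zero B {n} (λ _ → refl))))
                          (ℤP.+-identityˡ _)

    encode≡lead : ∀ e t t' → (∀ i j → ∣ e i j ∣ ℕ.< B) → encode e t ≡ ℤ.+ K * t' →
                  t ≡ t' × ∀ i j → e i j ≡ 0ℤ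
    encode≡lead e t t' ∣e∣<B e,t≡Kt' =
      let t-t'≡0 , e≡0 = encode≡0 e (t - t') ∣e∣<B e,t-t'≡0 in ℤP.i-j≡0⇒i≡j t t' t-t'≡0 , e≡0
      where
      shift : ∀ r k t t' → r + k * (t - t') ≡ (r + k * t) - k * t'
      shift = solve-∀
      e,t-t'≡0 : encode e (t - t') ≡ 0ℤ
      e,t-t'≡0 = trans (shift (rows e) (ℤ.+ K) t t')
                       (trans (cong (_- ℤ.+ K * t') e,t≡Kt') (ℤP.+-inverseʳ (ℤ.+ K * t')))

    encode-pos₁ : ∀ e → (∀ i j → ∣ e i j ∣ ℕ.< B) → 0ℤ ℤ.< encode e 1ℤ
    encode-pos₁ e ∣e∣<B rewrite ℤP.*-identityʳ (ℤ.+ K) = ∣i∣<k⇒0<i+k (rows e) K (∣rows∣<K e ∣e∣<B)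

    encode-pos₀ : ∀ e x y → (∀ i j → ∣ e i j ∣ ℕ.< B) → (∀ i j → 0ℤ ℤ.≤ e i j) → e x y ≢ 0ℤ →
                  0ℤ ℤ.< encode e 0ℤ
    encode-pos₀ e x y ∣e∣<B e≥0 exy≢0 =
      ℤP.≤∧≢⇒< nonneg (λ 0≡e → exy≢0 (proj₂ (encode≡0 e 0ℤ ∣e∣<B (sym 0≡e)) x y))
      where
      nonneg : 0ℤ ℤ.≤ encode e 0ℤ
      nonneg = ℤP.≤-trans (fromDigits-nonneg (B ^ n) (λ i → fromDigits B (e i)) (λ i → fromDigits-nonneg B (e i) (e≥0 i)))
                          (ℤP.≤-reflexive (sym (trans (cong (rows e +_) (ℤP.*-zeroʳ (ℤ.+ K))) (ℤP.+-identityʳ (rows e)))))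

module CyclicPositions (n : ℕ) .{{_ : NonZero n}} where

  open import Data.Nat using (_+_; _∸_; _≤_; _<_)
  open import Data.Nat.DivMod using (_%_; _mod_; m<n⇒m%n≡m; m%n<n; m≤n⇒[n∸m]%m≡n%m)
  open import Data.Fin.Properties using (toℕ<n; toℕ-fromℕ<)
  open import Data.Nat.Tactic.RingSolver using (solve-∀)

  data Ahead (x : Fin n) (k : ℕ) (y : Fin n) : Set where
    direct  : toℕ x + k ≡ toℕ y     → Ahead x k y
    wrapped : toℕ x + k ≡ toℕ y + n → Ahead x k y

  -- L₁ a b and L₂ a b of Defs are, by definition, dist (nxt a) b and dist (nxt b) a.
  dist : Fin n → Fin n → ℕ
  dist x y = (toℕ y + n ∸ toℕ x) % n

  dist<n : ∀ x y → dist x y < n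
  dist<n x y = m%n<n _ n

  private
    1≤n : 1 ≤ n
    1≤n = ℕ.>-nonZero⁻¹ n

    %-below-2n : ∀ m → m < n + n → m % n ≡ m ⊎ m % n + n ≡ m
    %-below-2n m m<2n with m ℕP.<? n
    ... | yes m<n = inj₁ (m<n⇒m%n≡m m<n)
    ... | no  m≮n = inj₂ (trans (cong (_+ n) (trans (sym (m≤n⇒[n∸m]%m≡n%m n≤m)) (m<n⇒m%n≡m (ℕP.m<n+o⇒m∸n<o m n m<2n))))
                                (ℕP.m∸n+n≡m n≤m))
      where n≤m = ℕP.≮⇒≥ m≮n

    <n⇒≢+n : ∀ {u v} → u < n → u ≢ v + n
    <n⇒≢+n {u} {v} u<n u≡v+n = ℕP.<⇒≱ u<n (subst (n ≤_) (sym u≡v+n) (ℕP.m≤n+m n v))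

  ahead-dist : ∀ x y → Ahead x (dist x y) y
  ahead-dist x y with %-below-2n (toℕ y + n ∸ toℕ x) (ℕP.≤-<-trans (ℕP.m∸n≤m _ (toℕ x)) (ℕP.+-monoˡ-< n (toℕ<n y)))
  ... | inj₁ d≡ = wrapped (trans (cong (toℕ x +_) d≡) x+[y+n∸x]≡y+n)
    where x+[y+n∸x]≡y+n = ℕP.m+[n∸m]≡n (ℕP.≤-trans (ℕP.<⇒≤ (toℕ<n x)) (ℕP.m≤n+m n (toℕ y)))
  ... | inj₂ d+n≡ = direct (ℕP.+-cancelʳ-≡ n _ _ (trans (ℕP.+-assoc (toℕ x) _ n)
                      (trans (cong (toℕ x +_) d+n≡) (ℕP.m+[n∸m]≡n (ℕP.≤-trans (ℕP.<⇒≤ (toℕ<n x)) (ℕP.m≤n+m n (toℕ y)))))))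

  ahead-steps-unique : ∀ {x y k l} → k < n → l < n → Ahead x k y → Ahead x l y → k ≡ l
  ahead-steps-unique {x} _   _   (direct  p) (direct  q) = ℕP.+-cancelˡ-≡ (toℕ x) _ _ (trans p (sym q))
  ahead-steps-unique {x} _   _   (wrapped p) (wrapped q) = ℕP.+-cancelˡ-≡ (toℕ x) _ _ (trans p (sym q))
  ahead-steps-unique {x} {k = k} {l} _ l<n (direct p) (wrapped q) =
    ⊥-elim (<n⇒≢+n l<n (ℕP.+-cancelˡ-≡ (toℕ x) l (k + n) (trans q (trans (cong (_+ n) (sym p)) (ℕP.+-assoc (toℕ x) k n)))))
  ahead-steps-unique {x} {k = k} {l} k<n _ (wrapped p) (direct q) =
    ⊥-elim (<n⇒≢+n k<n (ℕP.+-cancelˡ-≡ (toℕ x) k (l + n) (trans p (trans (cong (_+ n) (sym q)) (ℕP.+-assoc (toℕ x) l n)))))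

  dist-unique : ∀ {x y k} → k < n → Ahead x k y → dist x y ≡ k
  dist-unique {x} {y} k<n = ahead-steps-unique (dist<n x y) k<n (ahead-dist x y)

  ahead-functional : ∀ {x y z k} → Ahead x k y → Ahead x k z → y ≡ z
  ahead-functional (direct  p) (direct  q) = toℕ-injective (trans (sym p) q)
  ahead-functional (wrapped p) (wrapped q) = toℕ-injective (ℕP.+-cancelʳ-≡ n _ _ (trans (sym p) q))
  ahead-functional {y = y} {z} (direct  p) (wrapped q) = ⊥-elim (<n⇒≢+n (toℕ<n y) (trans (sym p) q))
  ahead-functional {y = y} {z} (wrapped p) (direct  q) = ⊥-elim (<n⇒≢+n (toℕ<n z) (trans (sym q) p))

  ahead-mod : ∀ x k → k ≤ n → Ahead x k ((toℕ x + k) mod n)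
  ahead-mod x k k≤n with %-below-2n (toℕ x + k) (ℕP.+-mono-<-≤ (toℕ<n x) k≤n)
  ... | inj₁ r≡ = direct  (sym (trans (toℕ-fromℕ< _) r≡))
  ... | inj₂ r≡ = wrapped (sym (trans (cong (_+ n) (toℕ-fromℕ< _)) r≡))

  ahead-nxt : ∀ x → Ahead x 1 (nxt x)
  ahead-nxt x = subst (Ahead x 1) (cong (_mod n) (ℕP.+-comm (toℕ x) 1)) (ahead-mod x 1 1≤n)

  ahead-refl : ∀ x → Ahead x 0 x
  ahead-refl x = direct (ℕP.+-identityʳ (toℕ x))

  private
    right-comm : ∀ a b c → a + b + c ≡ a + c + b
    right-comm = solve-∀

    ahead-+-assoc : ∀ (x : Fin n) k l → toℕ x + (k + l) ≡ toℕ x + k + l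
    ahead-+-assoc x k l = sym (ℕP.+-assoc (toℕ x) k l)

  ahead-trans : ∀ {x y z k l} → Ahead x k y → Ahead y l z → k + l < n → Ahead x (k + l) z
  ahead-trans {x} {y} {z} {k} {l} (direct p) (direct q) _ =
    direct (trans (ahead-+-assoc x k l) (trans (cong (_+ l) p) q))
  ahead-trans {x} {y} {z} {k} {l} (direct p) (wrapped q) _ =
    wrapped (trans (ahead-+-assoc x k l) (trans (cong (_+ l) p) q))
  ahead-trans {x} {y} {z} {k} {l} (wrapped p) (direct q) _ =
    wrapped (trans (ahead-+-assoc x k l) (trans (cong (_+ l) p) (trans (right-comm (toℕ y) n l) (cong (_+ n) q))))
  ahead-trans {x} {y} {z} {k} {l} (wrapped p) (wrapped q) k+l<n = ⊥-elim (ℕP.<⇒≱ x+k+l<2n (begin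
    n + n           ≤⟨ ℕP.+-monoˡ-≤ n (ℕP.m≤n+m n (toℕ z)) ⟩
    toℕ z + n + n   ≡⟨ cong (_+ n) (sym q) ⟩
    toℕ y + l + n   ≡⟨ right-comm (toℕ y) l n ⟩
    toℕ y + n + l   ≡⟨ cong (_+ l) (sym p) ⟩
    toℕ x + k + l   ≡⟨ sym (ahead-+-assoc x k l) ⟩
    toℕ x + (k + l) ∎))
    where
    open ℕP.≤-Reasoning
    x+k+l<2n = ℕP.+-mono-< (toℕ<n x) k+l<n

  ahead-cancel : ∀ {x y z k l} → Ahead x k y → Ahead x (k + l) z → Ahead y l z
  ahead-cancel {x} {y} {z} {k} {l} (direct p) (direct q) =
    direct (trans (cong (_+ l) (sym p)) (trans (sym (ahead-+-assoc x k l)) q))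
  ahead-cancel {x} {y} {z} {k} {l} (direct p) (wrapped q) =
    wrapped (trans (cong (_+ l) (sym p)) (trans (sym (ahead-+-assoc x k l)) q))
  ahead-cancel {x} {y} {z} {k} {l} (wrapped p) (direct q) = ⊥-elim (<n⇒≢+n (toℕ<n z) (begin
    toℕ z           ≡⟨ sym q ⟩
    toℕ x + (k + l) ≡⟨ ahead-+-assoc x k l ⟩
    toℕ x + k + l   ≡⟨ cong (_+ l) p ⟩
    toℕ y + n + l   ≡⟨ right-comm (toℕ y) n l ⟩
    toℕ y + l + n   ∎))
    where open ≡-Reasoning
  ahead-cancel {x} {y} {z} {k} {l} (wrapped p) (wrapped q) = direct (ℕP.+-cancelʳ-≡ n _ _ (begin
    toℕ y + l + n   ≡⟨ right-comm (toℕ y) l n ⟩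
    toℕ y + n + l   ≡⟨ cong (_+ l) (sym p) ⟩
    toℕ x + k + l   ≡⟨ sym (ahead-+-assoc x k l) ⟩
    toℕ x + (k + l) ≡⟨ q ⟩
    toℕ z + n       ∎))
    where open ≡-Reasoning

  ahead-complement : ∀ {x y k} → k ≤ n → Ahead x k y → Ahead y (n ∸ k) x
  ahead-complement {x} {y} {k} k≤n (direct p) = wrapped (begin
    toℕ y + (n ∸ k)   ≡⟨ cong (_+ (n ∸ k)) (sym p) ⟩
    toℕ x + k + (n ∸ k) ≡⟨ ℕP.+-assoc (toℕ x) k (n ∸ k) ⟩
    toℕ x + (k + (n ∸ k)) ≡⟨ cong (toℕ x +_) (ℕP.m+[n∸m]≡n k≤n) ⟩
    toℕ x + n ∎)
    where open ≡-Reasoning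
  ahead-complement {x} {y} {k} k≤n (wrapped p) = direct (ℕP.+-cancelʳ-≡ k _ _ (begin
    toℕ y + (n ∸ k) + k   ≡⟨ ℕP.+-assoc (toℕ y) (n ∸ k) k ⟩
    toℕ y + (n ∸ k + k)   ≡⟨ cong (toℕ y +_) (ℕP.m∸n+n≡m k≤n) ⟩
    toℕ y + n             ≡⟨ sym p ⟩
    toℕ x + k ∎))
    where open ≡-Reasoning

  ahead-back : ∀ x → Ahead (nxt x) (n ∸ 1) x
  ahead-back x = ahead-complement 1≤n (ahead-nxt x)

  n∸1<n : n ∸ 1 < n
  n∸1<n = ℕP.∸-monoʳ-< (s≤s z≤n) 1≤n

  dist-self : ∀ x → dist x x ≡ 0
  dist-self x = dist-unique (ℕP.≤-trans (s≤s z≤n) 1≤n) (ahead-refl x)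

  dist-back : ∀ x → dist (nxt x) x ≡ n ∸ 1
  dist-back x = dist-unique n∸1<n (ahead-back x)

  dist-flip : ∀ {x y} → x ≢ y → dist y x ≡ n ∸ dist x y
  dist-flip {x} {y} x≢y = dist-unique (ℕP.∸-monoʳ-< 0<k (ℕP.<⇒≤ (dist<n x y)))
                                      (ahead-complement (ℕP.<⇒≤ (dist<n x y)) (ahead-dist x y))
    where
    0<k : 0 < dist x y
    0<k = ℕP.n≢0⇒n>0 (λ k≡0 → x≢y (ahead-functional (ahead-refl x) (subst (λ k → Ahead x k y) k≡0 (ahead-dist x y))))

  nxt-injective : ∀ {x y} → nxt x ≡ nxt y → x ≡ y
  nxt-injective {x} {y} eq = ahead-functional (ahead-back x) (subst (λ z → Ahead z (n ∸ 1) y) (sym eq) (ahead-back y))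

  dist-nxt : ∀ {x y} → y ≢ x → dist x y ≡ suc (dist (nxt x) y)
  dist-nxt {x} {y} y≢x with ℕP.m≤n⇒m<n∨m≡n (dist<n (nxt x) y)
  ... | inj₁ 1+k<n = dist-unique 1+k<n (ahead-trans (ahead-nxt x) (ahead-dist (nxt x) y) 1+k<n)
  ... | inj₂ 1+k≡n = ⊥-elim (y≢x (ahead-functional n∸1-ahead (ahead-back x)))
    where n∸1-ahead = subst (λ k → Ahead (nxt x) k y) (cong ℕ.pred 1+k≡n) (ahead-dist (nxt x) y)

  nxt²≢id : 3 ≤ n → ∀ x → nxt (nxt x) ≢ x
  nxt²≢id 3≤n x nxt²x≡x with ahead-steps-unique 3≤n (ℕP.≤-trans (s≤s z≤n) 1≤n)
                              (subst (Ahead x 2) nxt²x≡x (ahead-trans (ahead-nxt x) (ahead-nxt (nxt x)) 3≤n)) (ahead-refl x)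
  ... | ()

  prv : Fin n → Fin n
  prv x = (toℕ x + (n ∸ 1)) mod n

  nxt-prv : ∀ x → nxt (prv x) ≡ x
  nxt-prv x = ahead-functional (ahead-nxt (prv x)) (subst (λ k → Ahead (prv x) k x) (ℕP.m∸[m∸n]≡n 1≤n) prv-ahead)
    where prv-ahead = ahead-complement (ℕP.m∸n≤m n 1) (ahead-mod x (n ∸ 1) (ℕP.m∸n≤m n 1))

  open Signs
  open import Data.Integer using (_^_) renaming (_+_ to _+ℤ_; _*_ to _*ℤ_)

  pairSign : Fin n → Fin n → Fin n → ℤ
  pairSign a b q = -1ℤ ^ dist (nxt a) q +ℤ -1ℤ ^ dist (nxt b) q

  pairSign-comm : ∀ a b q → pairSign a b q ≡ pairSign b a q
  pairSign-comm a b q = ℤP.+-comm (-1ℤ ^ dist (nxt a) q) (-1ℤ ^ dist (nxt b) q)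

  pairSign-consecutive-off : ∀ {a q} → q ≢ nxt a → pairSign a (nxt a) q ≡ 0ℤ
  pairSign-consecutive-off {a} {q} q≢a⁺ = begin
    -1ℤ ^ dist a⁺ q +ℤ s          ≡⟨ cong (λ k → -1ℤ ^ k +ℤ s) (dist-nxt q≢a⁺) ⟩
    -1ℤ *ℤ s +ℤ s                 ≡⟨ cong (_+ℤ s) (ℤP.-1*i≡-i s) ⟩
    ℤ.- s +ℤ s                    ≡⟨ ℤP.+-inverseˡ s ⟩
    0ℤ                            ∎
    where
    open ≡-Reasoning
    a⁺ = nxt a
    s = -1ℤ ^ dist (nxt a⁺) q

  OnP0-swap : ∀ {a b q d d'} → OnP0 a b q d d' → OnP0 b a q d' d
  OnP0-swap = Data.Sum.swap

  module _ (n-odd : ¬ 2 ∣ n) where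

    -1^[n∸1]≡1 : -1ℤ ^ (n ∸ 1) ≡ 1ℤ
    -1^[n∸1]≡1 = begin
      -1ℤ ^ (n ∸ 1)                  ≡⟨ sym (-1*-1*i≡i _) ⟩
      -1ℤ *ℤ -1ℤ ^ suc (n ∸ 1)       ≡⟨ cong (λ k → -1ℤ *ℤ -1ℤ ^ k) (ℕP.suc-pred n) ⟩
      -1ℤ *ℤ -1ℤ ^ n                 ≡⟨ cong (-1ℤ *ℤ_) (-1^odd≡-1 n-odd) ⟩
      1ℤ                             ∎
      where open ≡-Reasoning

    pairSign-consecutive-at : ∀ a → pairSign a (nxt a) (nxt a) ≡ ℤ.+ 2
    pairSign-consecutive-at a =
      cong₂ _+ℤ_ (cong (-1ℤ ^_) (dist-self (nxt a))) (trans (cong (-1ℤ ^_) (dist-back (nxt a))) -1^[n∸1]≡1)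

    module _ {a b : Fin n} (a≢b : a ≢ b) where

      arcs : suc (L₁ a b) + suc (L₂ a b) ≡ n
      arcs = begin
        suc (L₁ a b) + suc (L₂ a b) ≡⟨ cong₂ _+_ (sym (dist-nxt (a≢b ∘ sym))) (sym (dist-nxt a≢b)) ⟩
        dist a b + dist b a         ≡⟨ cong (dist a b +_) (dist-flip a≢b) ⟩
        dist a b + (n ∸ dist a b)   ≡⟨ ℕP.m+[n∸m]≡n (ℕP.<⇒≤ (dist<n a b)) ⟩
        n                           ∎
        where open ≡-Reasoning

      ahead-arc₁ : Ahead (nxt a) (suc (L₁ a b)) (nxt b)
      ahead-arc₁ = subst (λ l → Ahead (nxt a) l (nxt b)) (ℕP.+-comm (L₁ a b) 1)
                     (ahead-trans (ahead-dist (nxt a) b) (ahead-nxt b) L₁+1<n)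
        where
        L₁+1<n : L₁ a b + 1 < n
        L₁+1<n = subst (_< n) (ℕP.+-comm 1 (L₁ a b)) (subst (suc (L₁ a b) <_) arcs (ℕP.m<m+n _ (s≤s z≤n)))

      arc-cover : ∀ q → (∃[ k ] k ≤ L₁ a b × Ahead (nxt a) k q) ⊎ (∃[ k ] k ≤ L₂ a b × Ahead (nxt b) k q)
      arc-cover q with dist (nxt a) q ℕP.≤? L₁ a b
      ... | yes k≤L₁ = inj₁ (_ , k≤L₁ , ahead-dist (nxt a) q)
      ... | no  k≰L₁ = inj₂ (k ∸ suc (L₁ a b) , k'≤L₂ ,
                             ahead-cancel ahead-arc₁ (subst (λ l → Ahead (nxt a) l q) (sym k≡) (ahead-dist (nxt a) q)))
        where
        k = dist (nxt a) q
        L₁<k = ℕP.≰⇒> k≰L₁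
        k≡ : suc (L₁ a b) + (k ∸ suc (L₁ a b)) ≡ k
        k≡ = ℕP.m+[n∸m]≡n L₁<k
        k'≤L₂ : k ∸ suc (L₁ a b) ≤ L₂ a b
        k'≤L₂ = ℕP.+-cancelˡ-≤ (suc (L₁ a b)) _ _
                  (ℕ.s≤s⁻¹ (subst₂ _<_ (sym k≡) (trans (sym arcs) (ℕP.+-suc (suc (L₁ a b)) (L₂ a b))) (dist<n (nxt a) q)))

      pairSign-arc₁ : ∀ {k q} → k ≤ L₁ a b → Ahead (nxt a) k q →
                      pairSign a b q ≡ -1ℤ ^ k +ℤ -1ℤ ^ k *ℤ -1ℤ ^ L₁ a b
      pairSign-arc₁ {k} {q} k≤L₁ ahead = cong₂ _+ℤ_ (cong (-1ℤ ^_) dist₁) sign₂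
        where
        m = suc (L₂ a b) + k
        m<n : m < n
        m<n = ℕP.≤-<-trans (ℕP.+-monoʳ-≤ (suc (L₂ a b)) k≤L₁)
                (subst (suc (L₂ a b) + L₁ a b <_) (trans (rotate (L₁ a b) (L₂ a b)) arcs) ℕP.≤-refl)
          where
          rotate : ∀ x y → suc (suc y + x) ≡ suc x + suc y
          rotate = solve-∀
        dist₁ : dist (nxt a) q ≡ k
        dist₁ = dist-unique (ℕP.≤-<-trans (ℕP.m≤n+m k _) m<n) ahead
        b→a : Ahead (nxt b) (suc (L₂ a b)) (nxt a)
        b→a = subst (λ l → Ahead (nxt b) l (nxt a)) (ℕP.+-comm (L₂ a b) 1)
                (ahead-trans (ahead-dist (nxt b) a) (ahead-nxt a)
                  (subst (_< n) (ℕP.+-comm 1 (L₂ a b)) (ℕP.≤-<-trans (ℕP.m≤m+n _ k) m<n)))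
        sign₂ : -1ℤ ^ dist (nxt b) q ≡ -1ℤ ^ k *ℤ -1ℤ ^ L₁ a b
        sign₂ = begin
          -1ℤ ^ dist (nxt b) q                ≡⟨ cong (-1ℤ ^_) (dist-unique m<n (ahead-trans b→a ahead m<n)) ⟩
          -1ℤ ^ (suc (L₂ a b) + k)            ≡⟨ -1^-+ (suc (L₂ a b)) k ⟩
          -1ℤ ^ suc (L₂ a b) *ℤ -1ℤ ^ k       ≡⟨ cong (_*ℤ -1ℤ ^ k) (-1^-complement {L₁ a b} (cong ℕ.pred arcs) -1^[n∸1]≡1) ⟩
          -1ℤ ^ L₁ a b *ℤ -1ℤ ^ k             ≡⟨ ℤP.*-comm (-1ℤ ^ L₁ a b) _ ⟩
          -1ℤ ^ k *ℤ -1ℤ ^ L₁ a b             ∎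
          where open ≡-Reasoning

      private
        L₁<n : L₁ a b < n
        L₁<n = subst (L₁ a b <_) arcs (ℕP.m≤m+n (suc (L₁ a b)) _)

      pairSign-even-arc₁ : ∀ {k q} → 2 ∣ L₁ a b → k ≤ L₁ a b → Ahead (nxt a) k q →
                           pairSign a b q ≡ -1ℤ ^ k +ℤ -1ℤ ^ k
      pairSign-even-arc₁ {k} 2∣L₁ k≤L₁ ahead =
        trans (pairSign-arc₁ k≤L₁ ahead)
              (cong (-1ℤ ^ k +ℤ_) (trans (cong (-1ℤ ^ k *ℤ_) (-1^even≡1 2∣L₁)) (ℤP.*-identityʳ _)))

      pairSign-odd-arc₁ : ∀ {k q} → ¬ 2 ∣ L₁ a b → k ≤ L₁ a b → Ahead (nxt a) k q → pairSign a b q ≡ 0ℤ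
      pairSign-odd-arc₁ {k} 2∤L₁ k≤L₁ ahead = begin
        pairSign a _ _                       ≡⟨ pairSign-arc₁ k≤L₁ ahead ⟩
        -1ℤ ^ k +ℤ -1ℤ ^ k *ℤ -1ℤ ^ L₁ a b   ≡⟨ cong (λ s → -1ℤ ^ k +ℤ -1ℤ ^ k *ℤ s) (-1^odd≡-1 2∤L₁) ⟩
        -1ℤ ^ k +ℤ -1ℤ ^ k *ℤ -1ℤ            ≡⟨ cong (-1ℤ ^ k +ℤ_) (trans (ℤP.*-comm (-1ℤ ^ k) -1ℤ) (ℤP.-1*i≡-i _)) ⟩
        -1ℤ ^ k +ℤ ℤ.- (-1ℤ ^ k)             ≡⟨ ℤP.+-inverseʳ (-1ℤ ^ k) ⟩
        0ℤ                                   ∎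
        where open ≡-Reasoning

      arc₁-point⇒ahead : ∀ {k q} → k ≤ L₁ a b → (toℕ (nxt a) + k) mod n ≡ q → Ahead (nxt a) k q
      arc₁-point⇒ahead {k} k≤L₁ refl = ahead-mod (nxt a) k (ℕP.<⇒≤ (ℕP.≤-<-trans k≤L₁ L₁<n))

      ahead⇒arc₁-point : ∀ {k q} → k ≤ L₁ a b → Ahead (nxt a) k q → (toℕ (nxt a) + k) mod n ≡ q
      ahead⇒arc₁-point k≤L₁ ahead = ahead-functional (arc₁-point⇒ahead k≤L₁ refl) ahead

    pairSign-onP0 : ∀ {a b q d d'} → a ≢ b → OnP0 a b q d d' → pairSign a b q ≡ -1ℤ ^ d +ℤ -1ℤ ^ d
    pairSign-onP0 a≢b (inj₁ (2∣L₁ , k , k≤L₁ , at-q , refl , _)) =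
      pairSign-even-arc₁ a≢b 2∣L₁ k≤L₁ (arc₁-point⇒ahead a≢b k≤L₁ at-q)
    pairSign-onP0 {a} {b} {q} a≢b (inj₂ (2∣L₂ , k , k≤L₂ , at-q , refl , refl)) = begin
      pairSign a b q                      ≡⟨ pairSign-comm a b q ⟩
      pairSign b a q                      ≡⟨ pairSign-even-arc₁ b≢a 2∣L₂ k≤L₂ (arc₁-point⇒ahead b≢a k≤L₂ at-q) ⟩
      -1ℤ ^ k +ℤ -1ℤ ^ k                  ≡⟨ cong (λ s → s +ℤ s) (sym -1^[L₂∸k]≡-1^k) ⟩
      -1ℤ ^ (L₂ a b ∸ k) +ℤ -1ℤ ^ (L₂ a b ∸ k) ∎
      where
      open ≡-Reasoning
      -1^[L₂∸k]≡-1^k : -1ℤ ^ (L₂ a b ∸ k) ≡ -1ℤ ^ k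
      b≢a = a≢b ∘ sym
      -1^[L₂∸k]≡-1^k = trans (-1^-∸ k≤L₂) (trans (cong (_*ℤ -1ℤ ^ k) (-1^even≡1 2∣L₂)) (ℤP.*-identityˡ _))

    pairSign-offP0 : ∀ {a b q} → a ≢ b → ¬ (∃[ d ] ∃[ d' ] OnP0 a b q d d') → pairSign a b q ≡ 0ℤ
    pairSign-offP0 {a} {b} {q} a≢b q∉P0 with arc-cover a≢b q
    ... | inj₁ (k , k≤L₁ , ahead) with -1^-parity (L₁ a b)
    ...   | inj₁ (2∣L₁ , _) =
      ⊥-elim (q∉P0 (k , _ , inj₁ (2∣L₁ , k , k≤L₁ , ahead⇒arc₁-point a≢b k≤L₁ ahead , refl , refl)))
    ...   | inj₂ (2∤L₁ , _) = pairSign-odd-arc₁ a≢b 2∤L₁ k≤L₁ ahead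
    pairSign-offP0 {a} {b} {q} a≢b q∉P0 | inj₂ (k , k≤L₂ , ahead) with -1^-parity (L₂ a b)
    ...   | inj₁ (2∣L₂ , _) =
      ⊥-elim (q∉P0 (_ , k , OnP0-swap (inj₁ (2∣L₂ , k , k≤L₂ , ahead⇒arc₁-point (a≢b ∘ sym) k≤L₂ ahead , refl , refl))))
    ...   | inj₂ (2∤L₂ , _) = trans (pairSign-comm a b q) (pairSign-odd-arc₁ (a≢b ∘ sym) 2∤L₂ k≤L₂ ahead)

module EdgeSets {n : ℕ} (G : Graph n) where

  open import Data.Bool using (Bool; true; false; _∧_; _∨_; T)
  open import Data.Bool.Properties using (∧-zeroʳ)
  open import Data.Nat using (_<ᵇ_; _<_)
  open import Relation.Binary.Definitions using (tri<; tri≈; tri>)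
  open import Data.Unit using (tt)
  open import Relation.Nullary.Decidable using (⌊_⌋)
  open import Function.Bundles using (_⇔_; mk⇔; Equivalence)

  ∈Eᵇ : EdgeSet n → Fin n → Fin n → Bool
  ∈Eᵇ F i j = (toℕ i <ᵇ toℕ j) ∧ adj G i j ∧ F i j

  ∈Eᵇ⇒∈E : ∀ F i j → ∈Eᵇ F i j ≡ true → (i , j) ∈E[ G ] F
  ∈Eᵇ⇒∈E F i j eq with toℕ i <ᵇ toℕ j in i<j | adj G i j in ij∈G | F i j in ij∈F
  ∈Eᵇ⇒∈E F i j eq | true  | true  | true = ℕP.<ᵇ⇒< (toℕ i) (toℕ j) (subst T (sym i<j) tt) , refl , refl
  ∈Eᵇ⇒∈E F i j () | false | _     | _
  ∈Eᵇ⇒∈E F i j () | true  | false | _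
  ∈Eᵇ⇒∈E F i j () | true  | true  | false

  ∈E⇒∈Eᵇ : ∀ F i j → (i , j) ∈E[ G ] F → ∈Eᵇ F i j ≡ true
  ∈E⇒∈Eᵇ F i j (i<j , ij∈G , ij∈F) rewrite ij∈G | ij∈F with toℕ i <ᵇ toℕ j | ℕP.<⇒<ᵇ i<j
  ... | true | _ = refl

  ∈Eᵇ-cong : ∀ {F F'} → F ≐E[ G ] F' → ∀ i j → ∈Eᵇ F i j ≡ ∈Eᵇ F' i j
  ∈Eᵇ-cong {F} {F'} (F⊆F' , F'⊆F) i j with ∈Eᵇ F i j in ij∈F | ∈Eᵇ F' i j in ij∈F'
  ... | true  | true  = refl
  ... | false | false = refl
  ... | true  | false = sym (trans (sym ij∈F') (∈E⇒∈Eᵇ F' i j (F⊆F' i j (∈Eᵇ⇒∈E F i j ij∈F))))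
  ... | false | true  = trans (sym ij∈F) (∈E⇒∈Eᵇ F i j (F'⊆F i j (∈Eᵇ⇒∈E F' i j ij∈F')))

  star-incident : ∀ {v i j} → (i , j) ∈E[ G ] star G v → i ≡ v ⊎ j ≡ v
  star-incident {v} {i} {j} (_ , _ , ij∈star) with i ≟ v | j ≟ v
  ... | yes i≡v | _       = inj₁ i≡v
  ... | no  _   | yes j≡v = inj₂ j≡v
  ... | no  _   | no  _   = ⊥-elim (case trans (sym (∧-zeroʳ (adj G i j))) ij∈star of λ ())

  incident-star : ∀ {v i j} → toℕ i < toℕ j → Adj G i j → i ≡ v ⊎ j ≡ v → (i , j) ∈E[ G ] star G v
  incident-star {v} {i} {j} i<j ij∈G i≡v⊎j≡v = i<j , ij∈G , trans (cong (_∧ _) ij∈G) (incidence i≡v⊎j≡v)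
    where
    incidence : i ≡ v ⊎ j ≡ v → ⌊ i ≟ v ⌋ ∨ ⌊ j ≟ v ⌋ ≡ true
    incidence (inj₁ i≡v) with i ≟ v
    ... | yes _ = refl
    ... | no i≢v = ⊥-elim (i≢v i≡v)
    incidence (inj₂ j≡v) with i ≟ v | j ≟ v
    ... | yes _ | _     = refl
    ... | no _  | yes _ = refl
    ... | no _  | no j≢v = ⊥-elim (j≢v j≡v)

  private
    Adj⇒≢ : ∀ {u v} → Adj G u v → u ≢ v
    Adj⇒≢ {u} uv∈G refl = case trans (sym (irrefl G u)) uv∈G of λ ()

  ⊆star-neighbour : ∀ {v u w} → Adj G v u → star G v ⊆E[ G ] star G w → w ≡ v ⊎ w ≡ u
  ⊆star-neighbour {v} {u} {w} vu∈G sv⊆sw with ℕP.<-cmp (toℕ v) (toℕ u)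
  ... | tri≈ _ v≡u _ = ⊥-elim (Adj⇒≢ vu∈G (toℕ-injective v≡u))
  ... | tri< v<u _ _ = Data.Sum.map sym sym
                         (star-incident (sv⊆sw v u (incident-star v<u vu∈G (inj₁ refl))))
  ... | tri> _ _ u<v = Data.Sum.swap (Data.Sum.map sym sym
                         (star-incident (sv⊆sw u v (incident-star u<v uv∈G (inj₂ refl)))))
    where uv∈G = trans (Graph.sym G u v) vu∈G

  star-maximal : ∀ {v u₁ u₂ F} → u₁ ≢ u₂ → Adj G v u₁ → Adj G v u₂ → F ≐E[ G ] star G v → MaximalStar G F
  star-maximal {v} {u₁} {u₂} {F} u₁≢u₂ vu₁∈G vu₂∈G (F⊆sv , sv⊆F) = (v , F⊆sv , sv⊆F) , maximal
    where
    maximal : ∀ w → F ⊆E[ G ] star G w → star G w ⊆E[ G ] F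
    maximal w F⊆sw with ⊆star-neighbour vu₁∈G sv⊆sw | ⊆star-neighbour vu₂∈G sv⊆sw
      where sv⊆sw = λ i j → F⊆sw i j ∘ sv⊆F i j
    ... | inj₁ refl | _         = sv⊆F
    ... | inj₂ _    | inj₁ refl = sv⊆F
    ... | inj₂ refl | inj₂ refl = ⊥-elim (u₁≢u₂ refl)

  ∈Eᵇ-star : ∀ v {i j} → toℕ i < toℕ j → Adj G i j → ∈Eᵇ (star G v) i j ≡ true ⇔ (i ≡ v ⊎ j ≡ v)
  ∈Eᵇ-star v {i} {j} i<j ij∈G =
    mk⇔ (star-incident ∘ ∈Eᵇ⇒∈E (star G v) i j) (∈E⇒∈Eᵇ (star G v) i j ∘ incident-star i<j ij∈G)

  ∈Eᵇ-agree⇒≐ : ∀ {F F'} → (∀ {i j} → toℕ i < toℕ j → Adj G i j → ∈Eᵇ F i j ≡ ∈Eᵇ F' i j) → F ≐E[ G ] F'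
  ∈Eᵇ-agree⇒≐ {F} {F'} agree = transfer agree , transfer (λ i<j ij∈G → sym (agree i<j ij∈G))
    where
    transfer : ∀ {F F'} → (∀ {i j} → toℕ i < toℕ j → Adj G i j → ∈Eᵇ F i j ≡ ∈Eᵇ F' i j) → F ⊆E[ G ] F'
    transfer {F} {F'} agree i j ij∈F@(i<j , ij∈G , _) =
      ∈Eᵇ⇒∈E F' i j (trans (sym (agree i<j ij∈G)) (∈E⇒∈Eᵇ F i j ij∈F))

  open IntegerSums using (∑∑; ∑∑-cong; ∑∑-distrib-+)
  open import Data.Bool using (if_then_else_)

  ∑∑-over : (Fin n → Fin n → ℤ) → EdgeSet n → ℤ
  ∑∑-over w F = ∑∑ (λ i j → if ∈Eᵇ F i j then w i j else 0ℤ)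

  ∑∑-over-cong : ∀ w {F F'} → F ≐E[ G ] F' → ∑∑-over w F ≡ ∑∑-over w F'
  ∑∑-over-cong w F≐F' = ∑∑-cong (λ i j → cong (λ b → if b then w i j else 0ℤ) (∈Eᵇ-cong F≐F' i j))

  ∑∑-over-+ : ∀ h h' F → ∑∑-over (λ i j → h i j ℤ.+ h' i j) F ≡ ∑∑-over h F ℤ.+ ∑∑-over h' F
  ∑∑-over-+ h h' F =
    trans (∑∑-cong (λ i j → if-+ (∈Eᵇ F i j)))
          (∑∑-distrib-+ (λ i j → if ∈Eᵇ F i j then h i j else 0ℤ) (λ i j → if ∈Eᵇ F i j then h' i j else 0ℤ))
    where
    if-+ : ∀ {x y} b → (if b then x ℤ.+ y else 0ℤ) ≡ (if b then x else 0ℤ) ℤ.+ (if b then y else 0ℤ)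
    if-+ true  = refl
    if-+ false = refl

module ScaledWeights (M : ℕ) where

  open import Data.Rational as ℚ using (ℚ; 0ℚ; 1ℚ; toℚᵘ; fromℚᵘ)
  import Data.Rational.Properties as ℚP
  open import Data.Rational.Unnormalised as ℚᵘ using (mkℚᵘ; *≡*; *<*)
  import Data.Rational.Unnormalised.Properties as ℚᵘP
  open import Data.Integer.Tactic.RingSolver using (solve-∀)
  open import Data.Bool using (Bool; true; false; if_then_else_)

  -- mkℚᵘ z M is the unnormalised fraction z / (1 + M).
  scaled : ℤ → ℚ
  scaled z = fromℚᵘ (mkℚᵘ z M)

  private
    toℚᵘ-scaled : ∀ z → toℚᵘ (scaled z) ℚᵘ.≃ mkℚᵘ z M
    toℚᵘ-scaled z = ℚP.toℚᵘ-fromℚᵘ (mkℚᵘ z M)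

  scaled-+ : ∀ a b → scaled a ℚ.+ scaled b ≡ scaled (a ℤ.+ b)
  scaled-+ a b = ℚP.toℚᵘ-injective (ℚᵘP.≃-trans (ℚP.toℚᵘ-homo-+ (scaled a) (scaled b))
    (ℚᵘP.≃-trans (ℚᵘP.+-cong (toℚᵘ-scaled a) (toℚᵘ-scaled b))
                 (ℚᵘP.≃-trans common-denominator (ℚᵘP.≃-sym (toℚᵘ-scaled (a ℤ.+ b))))))
    where
    d = ℤ.+ suc M
    distrib : ∀ a b d → (a ℤ.* d ℤ.+ b ℤ.* d) ℤ.* d ≡ (a ℤ.+ b) ℤ.* (d ℤ.* d)
    distrib = solve-∀
    common-denominator : mkℚᵘ a M ℚᵘ.+ mkℚᵘ b M ℚᵘ.≃ mkℚᵘ (a ℤ.+ b) M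
    common-denominator = *≡* (trans (distrib a b d) (cong ((a ℤ.+ b) ℤ.*_) (sym (ℤP.pos-* (suc M) (suc M)))))

  scaled-0 : scaled 0ℤ ≡ 0ℚ
  scaled-0 = ℚP.toℚᵘ-injective (ℚᵘP.≃-trans (toℚᵘ-scaled 0ℤ) (*≡* refl))

  scaled-1+M : scaled (ℤ.+ suc M) ≡ 1ℚ
  scaled-1+M = ℚP.toℚᵘ-injective (ℚᵘP.≃-trans (toℚᵘ-scaled (ℤ.+ suc M))
                 (*≡* (trans (ℤP.*-identityʳ (ℤ.+ suc M)) (sym (ℤP.*-identityˡ (ℤ.+ suc M))))))

  scaled-injective : ∀ {a b} → scaled a ≡ scaled b → a ≡ b
  scaled-injective {a} {b} eq
    with ℚᵘP.≃-trans (ℚᵘP.≃-sym (toℚᵘ-scaled a)) (ℚᵘP.≃-trans (ℚᵘP.≃-reflexive (cong toℚᵘ eq)) (toℚᵘ-scaled b))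
  ... | *≡* a*d≡b*d = ℤP.*-cancelʳ-≡ a b (ℤ.+ suc M) a*d≡b*d

  scaled-pos : ∀ {a} → 0ℤ ℤ.< a → 0ℚ ℚ.< scaled a
  scaled-pos {a} 0<a = ℚP.toℚᵘ-cancel-< (ℚᵘP.<-respʳ-≃ (ℚᵘP.≃-sym (toℚᵘ-scaled a))
                         (*<* (subst (0ℤ ℤ.<_) (sym (ℤP.*-identityʳ a)) 0<a)))

  sumℚ-scaled : ∀ {m} {f : Fin m → ℚ} (g : Fin m → ℤ) → (∀ i → f i ≡ scaled (g i)) → sumℚ f ≡ scaled (sum g)
  sumℚ-scaled {zero}  g f≡g = sym scaled-0
  sumℚ-scaled {suc m} g f≡g =
    trans (cong₂ ℚ._+_ (f≡g zero) (sumℚ-scaled (g ∘ suc) (f≡g ∘ suc))) (scaled-+ (g zero) (sum (g ∘ suc)))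

  weight-scaled : ∀ {n} (G : Graph n) (w : Fin n → Fin n → ℤ) F →
                  weight G (λ i j → scaled (w i j)) F ≡ scaled (EdgeSets.∑∑-over G w F)
  weight-scaled G w F = sumℚ-scaled _ (λ i → sumℚ-scaled _ (λ j → if-scaled (EdgeSets.∈Eᵇ G F i j)))
    where
    if-scaled : ∀ {x} b → (if b then scaled x else 0ℚ) ≡ scaled (if b then x else 0ℤ)
    if-scaled true  = refl
    if-scaled false = sym scaled-0

module CycleEdges {n : ℕ} .{{_ : NonZero n}} {G : Graph n} (C : HamCycle G) where

  open HamCycle C
  open CyclicPositions n
  open import Data.Nat using (_<_)
  open import Relation.Binary.Definitions using (tri<; tri≈; tri>)
  open import Relation.Nullary using (¬?; _×-dec_)
  open import Function.Bundles using (_⇔_; mk⇔)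
  import Data.Bool

  σ⁻¹ : Fin n → Fin n
  σ⁻¹ v = proj₁ (σ-sur v)

  σ-σ⁻¹ : ∀ v → σ (σ⁻¹ v) ≡ v
  σ-σ⁻¹ v = proj₂ (σ-sur v)

  σ⁻¹-σ : ∀ p → σ⁻¹ (σ p) ≡ p
  σ⁻¹-σ p = σ-inj (σ-σ⁻¹ (σ p))

  CycleEdgeAt : Fin n → Fin n → Fin n → Set
  CycleEdgeAt p i j = (i ≡ σ p × j ≡ σ (nxt p)) ⊎ (j ≡ σ p × i ≡ σ (nxt p))

  CycleEdge : Fin n → Fin n → Set
  CycleEdge i j = ∃[ p ] CycleEdgeAt p i j

  -- Opaque, so that `with cycleEdge? i j` can still abstract the call inside `does (cycleEdge? i j)`.
  opaque
    cycleEdge? : ∀ i j → Dec (CycleEdge i j)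
    cycleEdge? i j with σ⁻¹ j ≟ nxt (σ⁻¹ i) | σ⁻¹ i ≟ nxt (σ⁻¹ j)
    ... | yes j⁻≡i⁻⁺ | _ = yes (σ⁻¹ i , inj₁ (sym (σ-σ⁻¹ i) , trans (sym (σ-σ⁻¹ j)) (cong σ j⁻≡i⁻⁺)))
    ... | no _ | yes i⁻≡j⁻⁺ = yes (σ⁻¹ j , inj₂ (sym (σ-σ⁻¹ j) , trans (sym (σ-σ⁻¹ i)) (cong σ i⁻≡j⁻⁺)))
    ... | no j⁻≢i⁻⁺ | no i⁻≢j⁻⁺ = no λ
      { (p , inj₁ (refl , refl)) → j⁻≢i⁻⁺ (trans (σ⁻¹-σ (nxt p)) (cong nxt (sym (σ⁻¹-σ p))))
      ; (p , inj₂ (refl , refl)) → i⁻≢j⁻⁺ (trans (σ⁻¹-σ (nxt p)) (cong nxt (sym (σ⁻¹-σ p)))) }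

  cycleEdgeAt-adj : ∀ {p i j} → CycleEdgeAt p i j → Adj G i j
  cycleEdgeAt-adj {p} (inj₁ (refl , refl)) = cyc p
  cycleEdgeAt-adj {p} (inj₂ (refl , refl)) = trans (Graph.sym G (σ (nxt p)) (σ p)) (cyc p)

  cycleEdgeAt-unique : ∀ {p p' i j} → CycleEdgeAt p i j → CycleEdgeAt p' i j → p ≡ p'
  cycleEdgeAt-unique (inj₁ (i≡ , _)) (inj₁ (i≡' , _)) = σ-inj (trans (sym i≡) i≡')
  cycleEdgeAt-unique (inj₂ (j≡ , _)) (inj₂ (j≡' , _)) = σ-inj (trans (sym j≡) j≡')
  cycleEdgeAt-unique {p} {p'} (inj₁ (i≡ , j≡)) (inj₂ (j≡' , i≡')) =
    ⊥-elim (nxt²≢id n≥3 p (trans (cong nxt (σ-inj (trans (sym j≡) j≡'))) (σ-inj (trans (sym i≡') i≡))))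
  cycleEdgeAt-unique (inj₂ x) (inj₁ y) = sym (cycleEdgeAt-unique (inj₁ y) (inj₂ x))

  cycleEdgeAt-determines : ∀ {p i j i' j'} → CycleEdgeAt p i j → CycleEdgeAt p i' j' →
                           toℕ i < toℕ j → toℕ i' < toℕ j' → (i , j) ≡ (i' , j')
  cycleEdgeAt-determines (inj₁ (refl , refl)) (inj₁ (refl , refl)) _ _ = refl
  cycleEdgeAt-determines (inj₂ (refl , refl)) (inj₂ (refl , refl)) _ _ = refl
  cycleEdgeAt-determines (inj₁ (refl , refl)) (inj₂ (refl , refl)) i<j j<i = ⊥-elim (ℕP.<-asym i<j j<i)
  cycleEdgeAt-determines (inj₂ (refl , refl)) (inj₁ (refl , refl)) j<i i<j = ⊥-elim (ℕP.<-asym i<j j<i)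

  canonicalEdge : ∀ p → ∃[ e ] (toℕ (proj₁ e) < toℕ (proj₂ e) × CycleEdgeAt p (proj₁ e) (proj₂ e))
  canonicalEdge p with ℕP.<-cmp (toℕ (σ p)) (toℕ (σ (nxt p)))
  ... | tri< lt _ _ = (σ p , σ (nxt p)) , lt , inj₁ (refl , refl)
  ... | tri> _ _ gt = (σ (nxt p) , σ p) , gt , inj₂ (refl , refl)
  ... | tri≈ _ eq _ =
    ⊥-elim (case trans (sym (irrefl G (σ p))) (subst (Adj G (σ p)) (sym (toℕ-injective eq)) (cyc p)) of λ ())

  edge : Fin n → Fin n × Fin n
  edge p = proj₁ (canonicalEdge p)

  edge< : ∀ p → toℕ (proj₁ (edge p)) < toℕ (proj₂ (edge p))
  edge< p = proj₁ (proj₂ (canonicalEdge p))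

  edge-at : ∀ p → CycleEdgeAt p (proj₁ (edge p)) (proj₂ (edge p))
  edge-at p = proj₂ (proj₂ (canonicalEdge p))

  edge-unique : ∀ {r i j} → toℕ i < toℕ j → CycleEdgeAt r i j → (i , j) ≡ edge r
  edge-unique {r} i<j at = cycleEdgeAt-determines at (edge-at r) i<j (edge< r)

  position-incident : ∀ {r i j} a → CycleEdgeAt r i j → (i ≡ σ (nxt a) ⊎ j ≡ σ (nxt a)) ⇔ (r ≡ a ⊎ r ≡ nxt a)
  position-incident {r} a at = mk⇔ (to at) (from at)
    where
    to : ∀ {i j} → CycleEdgeAt r i j → (i ≡ σ (nxt a) ⊎ j ≡ σ (nxt a)) → (r ≡ a ⊎ r ≡ nxt a)
    to (inj₁ (refl , refl)) (inj₁ σr≡σa⁺)  = inj₂ (σ-inj σr≡σa⁺)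
    to (inj₁ (refl , refl)) (inj₂ σr⁺≡σa⁺) = inj₁ (nxt-injective (σ-inj σr⁺≡σa⁺))
    to (inj₂ (refl , refl)) (inj₁ σr⁺≡σa⁺) = inj₁ (nxt-injective (σ-inj σr⁺≡σa⁺))
    to (inj₂ (refl , refl)) (inj₂ σr≡σa⁺)  = inj₂ (σ-inj σr≡σa⁺)
    from : ∀ {i j} → CycleEdgeAt r i j → (r ≡ a ⊎ r ≡ nxt a) → (i ≡ σ (nxt a) ⊎ j ≡ σ (nxt a))
    from (inj₁ (refl , refl)) (inj₁ refl) = inj₂ refl
    from (inj₁ (refl , refl)) (inj₂ refl) = inj₁ refl
    from (inj₂ (refl , refl)) (inj₁ refl) = inj₁ refl
    from (inj₂ (refl , refl)) (inj₂ refl) = inj₂ refl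

  positions-chord : ∀ {p q} → p ≢ nxt q → q ≢ nxt p → ¬ CycleEdge (σ p) (σ q)
  positions-chord p≢q⁺ q≢p⁺ (r , inj₁ (σp≡σr , σq≡σr⁺)) =
    q≢p⁺ (trans (σ-inj σq≡σr⁺) (cong nxt (sym (σ-inj σp≡σr))))
  positions-chord p≢q⁺ q≢p⁺ (r , inj₂ (σq≡σr , σp≡σr⁺)) =
    p≢q⁺ (trans (σ-inj σp≡σr⁺) (cong nxt (sym (σ-inj σq≡σr))))

  Chord : Fin n → Fin n → Set
  Chord i j = toℕ i < toℕ j × Adj G i j × ¬ CycleEdge i j

  opaque
    chord? : ∀ i j → Dec (Chord i j)
    chord? i j = ℕP._<?_ (toℕ i) (toℕ j) ×-dec (adj G i j Data.Bool.≟ Data.Bool.true) ×-dec ¬? (cycleEdge? i j)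

module Construction {n : ℕ} .{{_ : NonZero n}} {G : Graph n} (C : HamCycle G) (n-odd : ¬ 2 ∣ n) where

  open HamCycle C
  open CyclicPositions n
  open CycleEdges C
  open EdgeSets G
  open IntegerSums
  open Signs
  open PositionalNotation
  open import Data.Integer using (_+_; _*_; -_; _^_; ∣_∣)
  open import Data.Bool using (Bool; true; false; if_then_else_)
  open import Relation.Nullary using (does)
  open import Data.Product.Properties using (≡-dec)
  open import Algebra.Properties.Group (AbelianGroup.group ℤP.+-0-abelianGroup) using (inverseʳ-unique)
  open import Data.Integer.Tactic.RingSolver using (solve-∀)
  open import Function.Properties.Equivalence using () renaming (trans to ⇔-trans; sym to ⇔-sym)
  open import Relation.Binary.Definitions using (tri<; tri≈; tri>)
  import Data.Rational
  open import Function.Bundles using (_⇔_; mk⇔; Equivalence)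

  BadCycle : Set
  BadCycle = ∀ a b → DisjointEdges a b → NonCrossingEvenChord G C a b ⊎ CrossingOddChord G C a b

  _≟²_ : (x y : Fin n × Fin n) → Dec (x ≡ y)
  _≟²_ = ≡-dec _≟_ _≟_

  edgeSign : Fin n → Fin n → Fin n → ℤ
  edgeSign p g₁ g₂ = -1ℤ ^ dist (nxt p) (σ⁻¹ g₁) + -1ℤ ^ dist (nxt p) (σ⁻¹ g₂)

  lead : Fin n → Fin n → ℤ
  lead i j = if does (cycleEdge? i j) then 1ℤ else 0ℤ

  cycleTerm : Fin n → Fin n → Fin n → Fin n → ℤ
  cycleTerm i j with cycleEdge? i j
  ... | yes (p , _) = λ g₁ g₂ → - edgeSign p g₁ g₂
  ... | no  _       = λ _ _ → 0ℤ

  chordTerm : Fin n → Fin n → Fin n → Fin n → ℤ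
  chordTerm i j g₁ g₂ = if does ((i , j) ≟² (g₁ , g₂)) then ℤ.+ 2 else 0ℤ

  digit : Fin n → Fin n → Fin n → Fin n → ℤ
  digit i j g₁ g₂ = if does (chord? g₁ g₂) then cycleTerm i j g₁ g₂ + chordTerm i j g₁ g₂ else 0ℤ

  -- Exceeds every coordinate (in absolute value) of a sum of at most n² digit vectors, each bounded by 2.
  B : ℕ
  B = 3 ℕ.+ n ℕ.* (n ℕ.* 2)

  open MatrixEncoding B n

  w : Fin n → Fin n → ℤ
  w i j = encode (digit i j) (lead i j)

  private
    ∣edgeSign∣≤2 : ∀ p g₁ g₂ → ∣ edgeSign p g₁ g₂ ∣ ℕ.≤ 2
    ∣edgeSign∣≤2 p g₁ g₂ with -1^≡±1 (dist (nxt p) (σ⁻¹ g₁)) | -1^≡±1 (dist (nxt p) (σ⁻¹ g₂))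
    ... | inj₁ s₁ | inj₁ s₂ rewrite s₁ | s₂ = ℕP.≤-refl
    ... | inj₁ s₁ | inj₂ s₂ rewrite s₁ | s₂ = z≤n
    ... | inj₂ s₁ | inj₁ s₂ rewrite s₁ | s₂ = z≤n
    ... | inj₂ s₁ | inj₂ s₂ rewrite s₁ | s₂ = ℕP.≤-refl

    cycleTerm-nonCycle : ∀ {i j} → ¬ CycleEdge i j → ∀ g₁ g₂ → cycleTerm i j g₁ g₂ ≡ 0ℤ
    cycleTerm-nonCycle {i} {j} ¬ce g₁ g₂ with cycleEdge? i j
    ... | yes ce = ⊥-elim (¬ce ce)
    ... | no  _  = refl

    ∣cycleTerm∣≤2 : ∀ i j g₁ g₂ → ∣ cycleTerm i j g₁ g₂ ∣ ℕ.≤ 2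
    ∣cycleTerm∣≤2 i j g₁ g₂ with cycleEdge? i j
    ... | yes (p , _) = subst (ℕ._≤ 2) (sym (ℤP.∣-i∣≡∣i∣ (edgeSign p g₁ g₂))) (∣edgeSign∣≤2 p g₁ g₂)
    ... | no  _       = z≤n

  ∣digit∣≤2 : ∀ i j g₁ g₂ → ∣ digit i j g₁ g₂ ∣ ℕ.≤ 2
  ∣digit∣≤2 i j g₁ g₂ with chord? g₁ g₂ | (i , j) ≟² (g₁ , g₂)
  ... | no  _                  | _       = z≤n
  ... | yes (_ , _ , ¬ce)      | yes refl rewrite cycleTerm-nonCycle ¬ce g₁ g₂ = ℕP.≤-refl
  ... | yes _                  | no  _   =
    subst (ℕ._≤ 2) (cong ∣_∣ (sym (ℤP.+-identityʳ (cycleTerm i j g₁ g₂)))) (∣cycleTerm∣≤2 i j g₁ g₂)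

  lead-cycle : ∀ {i j} → CycleEdge i j → lead i j ≡ 1ℤ
  lead-cycle {i} {j} ce with cycleEdge? i j
  ... | yes _   = refl
  ... | no ¬ce = ⊥-elim (¬ce ce)

  lead-nonCycle : ∀ {i j} → ¬ CycleEdge i j → lead i j ≡ 0ℤ
  lead-nonCycle {i} {j} ¬ce with cycleEdge? i j
  ... | yes ce = ⊥-elim (¬ce ce)
  ... | no _   = refl

  private
    ∣digit∣<B : ∀ i j g₁ g₂ → ∣ digit i j g₁ g₂ ∣ ℕ.< B
    ∣digit∣<B i j g₁ g₂ = ℕP.≤-<-trans (∣digit∣≤2 i j g₁ g₂) (ℕP.m≤m+n 3 _)

  w-pos : ∀ {i j} → toℕ i ℕ.< toℕ j → Adj G i j → 0ℤ ℤ.< w i j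
  w-pos {i} {j} i<j ij∈G = case cycleEdge? i j of λ
    { (yes ce)  → subst (λ t → 0ℤ ℤ.< encode (digit i j) t) (sym (lead-cycle ce))
                    (encode-pos₁ (digit i j) (∣digit∣<B i j))
    ; (no ¬ce) → subst (λ t → 0ℤ ℤ.< encode (digit i j) t) (sym (lead-nonCycle ¬ce))
                   (encode-pos₀ (digit i j) i j (∣digit∣<B i j) (digit≥0 ¬ce) (digit-self≢0 ¬ce)) }
    where
    digit≥0 : ¬ CycleEdge i j → ∀ g₁ g₂ → 0ℤ ℤ.≤ digit i j g₁ g₂
    digit≥0 ¬ce g₁ g₂ with chord? g₁ g₂ | (i , j) ≟² (g₁ , g₂)
    ... | no _  | _     = ℤP.≤-refl
    ... | yes _ | yes _ rewrite cycleTerm-nonCycle ¬ce g₁ g₂ = ℤ.+≤+ z≤n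
    ... | yes _ | no  _ rewrite cycleTerm-nonCycle ¬ce g₁ g₂ = ℤP.≤-refl
    digit-self≢0 : ¬ CycleEdge i j → digit i j i j ≢ 0ℤ
    digit-self≢0 ¬ce with chord? i j | (i , j) ≟² (i , j)
    ... | no ¬chord | _ = ⊥-elim (¬chord (i<j , ij∈G , ¬ce))
    ... | yes _ | no ij≢ij = ⊥-elim (ij≢ij refl)
    ... | yes _ | yes _ rewrite cycleTerm-nonCycle ¬ce i j = λ ()

  leadSum : EdgeSet n → ℤ
  leadSum F = ∑∑-over lead F

  digitSum : EdgeSet n → Fin n → Fin n → ℤ
  digitSum F g₁ g₂ = ∑∑-over (λ i j → digit i j g₁ g₂) F

  ∑∑-over-w-encode : ∀ F → ∑∑-over w F ≡ encode (digitSum F) (leadSum F)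
  ∑∑-over-w-encode F = trans (∑∑-cong (λ i j → if-encode (∈Eᵇ F i j)))
                      (encode-∑∑ (λ i j g₁ g₂ → if ∈Eᵇ F i j then digit i j g₁ g₂ else 0ℤ)
                                 (λ i j → if ∈Eᵇ F i j then lead i j else 0ℤ))
    where
    if-encode : ∀ {i j} b → (if b then encode (digit i j) (lead i j) else 0ℤ) ≡
                            encode (λ g₁ g₂ → if b then digit i j g₁ g₂ else 0ℤ) (if b then lead i j else 0ℤ)
    if-encode true  = refl
    if-encode false = sym (trans (encode-lead 0ℤ) (ℤP.*-zeroʳ (ℤ.+ K)))

  2K : ℤ
  2K = ℤ.+ K * ℤ.+ 2

  ∑∑-over-w≡2K⇔ : ∀ F → ∑∑-over w F ≡ 2K ⇔ (leadSum F ≡ ℤ.+ 2 × ∀ g₁ g₂ → digitSum F g₁ g₂ ≡ 0ℤ)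
  ∑∑-over-w≡2K⇔ F = mk⇔
    (λ eq → encode≡lead (digitSum F) (leadSum F) (ℤ.+ 2) ∣digitSum∣<B (trans (sym (∑∑-over-w-encode F)) eq))
    (λ (lead≡2 , digits≡0) → trans (∑∑-over-w-encode F) (trans (encode-cong digits≡0 lead≡2) (encode-lead (ℤ.+ 2))))
    where
    ∣digitSum∣<B : ∀ g₁ g₂ → ∣ digitSum F g₁ g₂ ∣ ℕ.< B
    ∣digitSum∣<B g₁ g₂ = ℕP.≤-<-trans (∑∑-bound _ 2 ∣summand∣≤2) (ℕP.m<n+m _ (s≤s z≤n))
      where
      ∣summand∣≤2 : ∀ i j → ∣ (if ∈Eᵇ F i j then digit i j g₁ g₂ else 0ℤ) ∣ ℕ.≤ 2
      ∣summand∣≤2 i j with ∈Eᵇ F i j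
      ... | true  = ∣digit∣≤2 i j g₁ g₂
      ... | false = z≤n

  CycleEdgesOf : EdgeSet n → Fin n → Fin n → Set
  CycleEdgesOf F p₁ p₂ =
    ∀ {r i j} → toℕ i ℕ.< toℕ j → CycleEdgeAt r i j → ∈Eᵇ F i j ≡ true ⇔ (r ≡ p₁ ⊎ r ≡ p₂)

  chordSign : Fin n → Fin n → Fin n → Fin n → ℤ
  chordSign p₁ p₂ g₁ g₂ = pairSign p₁ p₂ (σ⁻¹ g₁) + pairSign p₁ p₂ (σ⁻¹ g₂)

  ChordCondition : EdgeSet n → Fin n → Fin n → Set
  ChordCondition F p₁ p₂ =
    ∀ {g₁ g₂} → Chord g₁ g₂ → (if ∈Eᵇ F g₁ g₂ then ℤ.+ 2 else 0ℤ) ≡ chordSign p₁ p₂ g₁ g₂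

  ∑∑-over-cycleEdges : ∀ {F p₁ p₂} → p₁ ≢ p₂ → CycleEdgesOf F p₁ p₂ →
                       ∀ h → (∀ i j → ¬ CycleEdge i j → h i j ≡ 0ℤ) →
                       ∑∑-over h F ≡ uncurry h (edge p₁) + uncurry h (edge p₂)
  ∑∑-over-cycleEdges {F} {p₁} {p₂} p₁≢p₂ edgesOf h h≡0 =
    trans (∑∑-support₂ _ (edge p₁) (edge p₂) (p₁≢p₂ ∘ edge-injective) outside)
          (cong₂ _+_ (inside p₁ (inj₁ refl)) (inside p₂ (inj₂ refl)))
    where
    edge-injective : edge p₁ ≡ edge p₂ → p₁ ≡ p₂
    edge-injective eq = cycleEdgeAt-unique (edge-at p₁) (subst (uncurry (CycleEdgeAt p₂)) (sym eq) (edge-at p₂))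
    inside : ∀ p → p ≡ p₁ ⊎ p ≡ p₂ →
             (if uncurry (∈Eᵇ F) (edge p) then uncurry h (edge p) else 0ℤ) ≡ uncurry h (edge p)
    inside p p∈ rewrite Equivalence.from (edgesOf (edge< p) (edge-at p)) p∈ = refl
    outside : ∀ i j → (i , j) ≢ edge p₁ → (i , j) ≢ edge p₂ → (if ∈Eᵇ F i j then h i j else 0ℤ) ≡ 0ℤ
    outside i j ≢e₁ ≢e₂ with ∈Eᵇ F i j in ij∈F
    ... | false = refl
    ... | true with cycleEdge? i j
    ...   | no ¬ce = h≡0 i j ¬ce
    ...   | yes (r , at) = ⊥-elim ([ ≢e₁ ∘ on-edge , ≢e₂ ∘ on-edge ] (Equivalence.to (edgesOf i<j at) ij∈F))
      where
      i<j = proj₁ (∈Eᵇ⇒∈E F i j ij∈F)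
      on-edge : ∀ {p} → r ≡ p → (i , j) ≡ edge p
      on-edge refl = edge-unique i<j at

  leadSum-cycleEdges : ∀ {F p₁ p₂} → p₁ ≢ p₂ → CycleEdgesOf F p₁ p₂ → leadSum F ≡ ℤ.+ 2
  leadSum-cycleEdges {p₁ = p₁} {p₂} p₁≢p₂ edgesOf =
    trans (∑∑-over-cycleEdges p₁≢p₂ edgesOf lead (λ _ _ → lead-nonCycle))
          (cong₂ _+_ (lead-cycle (p₁ , edge-at p₁)) (lead-cycle (p₂ , edge-at p₂)))

  private
    cycleTerm-at : ∀ {p i j} → CycleEdgeAt p i j → ∀ g₁ g₂ → cycleTerm i j g₁ g₂ ≡ - edgeSign p g₁ g₂
    cycleTerm-at {p} {i} {j} at g₁ g₂ with cycleEdge? i j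
    ... | yes (p' , at') = cong (λ r → - edgeSign r g₁ g₂) (cycleEdgeAt-unique at' at)
    ... | no ¬ce        = ⊥-elim (¬ce (p , at))

    digit-chord : ∀ {g₁ g₂} → Chord g₁ g₂ → ∀ i j → digit i j g₁ g₂ ≡ cycleTerm i j g₁ g₂ + chordTerm i j g₁ g₂
    digit-chord {g₁} {g₂} chord i j with chord? g₁ g₂
    ... | yes _      = refl
    ... | no ¬chord = ⊥-elim (¬chord chord)

    digit-nonChord : ∀ {g₁ g₂} → ¬ Chord g₁ g₂ → ∀ i j → digit i j g₁ g₂ ≡ 0ℤ
    digit-nonChord {g₁} {g₂} ¬chord i j with chord? g₁ g₂
    ... | yes chord = ⊥-elim (¬chord chord)
    ... | no _      = refl

    ∑∑-over-chordTerm : ∀ F g₁ g₂ →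
                        ∑∑-over (λ i j → chordTerm i j g₁ g₂) F ≡ (if ∈Eᵇ F g₁ g₂ then ℤ.+ 2 else 0ℤ)
    ∑∑-over-chordTerm F g₁ g₂ = trans (∑∑-support₁ _ (g₁ , g₂) outside) (at-g (∈Eᵇ F g₁ g₂))
      where
      outside : ∀ i j → (i , j) ≢ (g₁ , g₂) → (if ∈Eᵇ F i j then chordTerm i j g₁ g₂ else 0ℤ) ≡ 0ℤ
      outside i j ij≢g with ∈Eᵇ F i j | (i , j) ≟² (g₁ , g₂)
      ... | false | _        = refl
      ... | true  | no _     = refl
      ... | true  | yes ij≡g = ⊥-elim (ij≢g ij≡g)
      at-g : ∀ b → (if b then chordTerm g₁ g₂ g₁ g₂ else 0ℤ) ≡ (if b then ℤ.+ 2 else 0ℤ)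
      at-g false = refl
      at-g true with (g₁ , g₂) ≟² (g₁ , g₂)
      ... | yes _ = refl
      ... | no g≢g = ⊥-elim (g≢g refl)

  digitSum-cycleEdges : ∀ {F p₁ p₂ g₁ g₂} → p₁ ≢ p₂ → CycleEdgesOf F p₁ p₂ → Chord g₁ g₂ →
    digitSum F g₁ g₂ ≡ - chordSign p₁ p₂ g₁ g₂ + (if ∈Eᵇ F g₁ g₂ then ℤ.+ 2 else 0ℤ)
  digitSum-cycleEdges {F} {p₁} {p₂} {g₁} {g₂} p₁≢p₂ edgesOf chord = begin
    digitSum F g₁ g₂
      ≡⟨ ∑∑-cong (λ i j → cong (λ d → if ∈Eᵇ F i j then d else 0ℤ) (digit-chord chord i j)) ⟩
    ∑∑-over (λ i j → cycleTerm i j g₁ g₂ + chordTerm i j g₁ g₂) F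
      ≡⟨ ∑∑-over-+ (λ i j → cycleTerm i j g₁ g₂) (λ i j → chordTerm i j g₁ g₂) F ⟩
    ∑∑-over (λ i j → cycleTerm i j g₁ g₂) F + ∑∑-over (λ i j → chordTerm i j g₁ g₂) F
      ≡⟨ cong₂ _+_ (∑∑-over-cycleEdges p₁≢p₂ edgesOf _ (λ i j ¬ce → cycleTerm-nonCycle ¬ce g₁ g₂))
                   (∑∑-over-chordTerm F g₁ g₂) ⟩
    uncurry cycleTerm (edge p₁) g₁ g₂ + uncurry cycleTerm (edge p₂) g₁ g₂ + (if ∈Eᵇ F g₁ g₂ then ℤ.+ 2 else 0ℤ)
      ≡⟨ cong (_+ (if ∈Eᵇ F g₁ g₂ then ℤ.+ 2 else 0ℤ))
              (trans (cong₂ _+_ (cycleTerm-at (edge-at p₁) g₁ g₂) (cycleTerm-at (edge-at p₂) g₁ g₂))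
                     (regroup (s p₁ g₁) (s p₁ g₂) (s p₂ g₁) (s p₂ g₂))) ⟩
    - chordSign p₁ p₂ g₁ g₂ + (if ∈Eᵇ F g₁ g₂ then ℤ.+ 2 else 0ℤ) ∎
    where
    open ≡-Reasoning
    s : Fin n → Fin n → ℤ
    s p g = -1ℤ ^ dist (nxt p) (σ⁻¹ g)
    regroup : ∀ a₁ b₁ a₂ b₂ → - (a₁ + b₁) + - (a₂ + b₂) ≡ - ((a₁ + a₂) + (b₁ + b₂))
    regroup = solve-∀

  private
    leadSummand : EdgeSet n → Fin n → Fin n → ℤ
    leadSummand F i j = if ∈Eᵇ F i j then lead i j else 0ℤ

    leadSummand-bit : ∀ F i j → Bit (leadSummand F i j)
    leadSummand-bit F i j with ∈Eᵇ F i j | cycleEdge? i j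
    ... | false | _     = inj₁ refl
    ... | true  | yes _ = inj₂ refl
    ... | true  | no  _ = inj₁ refl

    leadSummand≡1 : ∀ F i j → leadSummand F i j ≡ 1ℤ → ∈Eᵇ F i j ≡ true × CycleEdge i j
    leadSummand≡1 F i j with ∈Eᵇ F i j | cycleEdge? i j
    ... | true  | yes ce = λ _ → refl , ce
    ... | true  | no  _  = λ ()
    ... | false | _      = λ ()

  leadSum≡2⇒ : ∀ F → leadSum F ≡ ℤ.+ 2 → ∃[ p₁ ] ∃[ p₂ ] (p₁ ≢ p₂ × CycleEdgesOf F p₁ p₂)
  leadSum≡2⇒ F lead≡2 with ∑∑-bits≡2 (leadSummand F) (leadSummand-bit F) lead≡2
  ... | (x₁ , x₂) , (y₁ , y₂) , x≢y , sx≡1 , sy≡1 , rest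
    with leadSummand≡1 F x₁ x₂ sx≡1 | leadSummand≡1 F y₁ y₂ sy≡1
  ... | x∈F , p₁ , at₁ | y∈F , p₂ , at₂ = p₁ , p₂ , p₁≢p₂ , λ i<j at → mk⇔ (to i<j at) (from i<j at)
    where
    x< = proj₁ (∈Eᵇ⇒∈E F x₁ x₂ x∈F)
    y< = proj₁ (∈Eᵇ⇒∈E F y₁ y₂ y∈F)
    p₁≢p₂ : p₁ ≢ p₂
    p₁≢p₂ refl = x≢y (cycleEdgeAt-determines at₁ at₂ x< y<)
    to : ∀ {r i j} → toℕ i ℕ.< toℕ j → CycleEdgeAt r i j → ∈Eᵇ F i j ≡ true → r ≡ p₁ ⊎ r ≡ p₂
    to {r} {i} {j} i<j at ij∈F with (i , j) ≟² (x₁ , x₂) | (i , j) ≟² (y₁ , y₂)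
    ... | yes refl | _        = inj₁ (cycleEdgeAt-unique at at₁)
    ... | no _     | yes refl = inj₂ (cycleEdgeAt-unique at at₂)
    ... | no ≢x    | no ≢y    = ⊥-elim (case trans (sym (rest i j ≢x ≢y)) summand≡1 of λ ())
      where
      summand≡1 : leadSummand F i j ≡ 1ℤ
      summand≡1 = trans (cong (λ b → if b then lead i j else 0ℤ) ij∈F) (lead-cycle (r , at))
    from : ∀ {r i j} → toℕ i ℕ.< toℕ j → CycleEdgeAt r i j → r ≡ p₁ ⊎ r ≡ p₂ → ∈Eᵇ F i j ≡ true
    from i<j at (inj₁ refl) = subst (λ e → uncurry (∈Eᵇ F) e ≡ true) (sym (cycleEdgeAt-determines at at₁ i<j x<)) x∈F
    from i<j at (inj₂ refl) = subst (λ e → uncurry (∈Eᵇ F) e ≡ true) (sym (cycleEdgeAt-determines at at₂ i<j y<)) y∈F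

  profile⇒∑∑-over-w≡2K : ∀ {F p₁ p₂} → p₁ ≢ p₂ → CycleEdgesOf F p₁ p₂ → ChordCondition F p₁ p₂ →
                         ∑∑-over w F ≡ 2K
  profile⇒∑∑-over-w≡2K {F} {p₁} {p₂} p₁≢p₂ edgesOf chordCondition =
    Equivalence.from (∑∑-over-w≡2K⇔ F) (leadSum-cycleEdges p₁≢p₂ edgesOf , digits≡0)
    where
    digits≡0 : ∀ g₁ g₂ → digitSum F g₁ g₂ ≡ 0ℤ
    digits≡0 g₁ g₂ = case chord? g₁ g₂ of λ
      { (yes chord)  → trans (digitSum-cycleEdges p₁≢p₂ edgesOf chord)
                             (trans (cong (- chordSign p₁ p₂ g₁ g₂ +_) (chordCondition chord))
                                    (ℤP.+-inverseˡ (chordSign p₁ p₂ g₁ g₂)))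
      ; (no ¬chord) → ∑∑-zero (λ i j → digit≡0 (∈Eᵇ F i j) (digit-nonChord ¬chord i j)) }
      where
      digit≡0 : ∀ {d} b → d ≡ 0ℤ → (if b then d else 0ℤ) ≡ 0ℤ
      digit≡0 true  d≡0 = d≡0
      digit≡0 false _   = refl

  ∑∑-over-w≡2K⇒profile : ∀ F → ∑∑-over w F ≡ 2K →
                         ∃[ p₁ ] ∃[ p₂ ] (p₁ ≢ p₂ × CycleEdgesOf F p₁ p₂ × ChordCondition F p₁ p₂)
  ∑∑-over-w≡2K⇒profile F weight≡2K with Equivalence.to (∑∑-over-w≡2K⇔ F) weight≡2K
  ... | lead≡2 , digits≡0 with leadSum≡2⇒ F lead≡2
  ...   | p₁ , p₂ , p₁≢p₂ , edgesOf = p₁ , p₂ , p₁≢p₂ , edgesOf , λ {g₁} {g₂} chord →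
    trans (inverseʳ-unique (- chordSign p₁ p₂ g₁ g₂) _
             (trans (sym (digitSum-cycleEdges p₁≢p₂ edgesOf chord)) (digits≡0 g₁ g₂)))
          (ℤP.neg-involutive (chordSign p₁ p₂ g₁ g₂))

  private
    pairSign-at-vertex : ∀ a {g} → g ≡ σ (nxt a) → pairSign a (nxt a) (σ⁻¹ g) ≡ ℤ.+ 2
    pairSign-at-vertex a refl = trans (cong (pairSign a (nxt a)) (σ⁻¹-σ (nxt a))) (pairSign-consecutive-at n-odd a)

    pairSign-off-vertex : ∀ a {g} → g ≢ σ (nxt a) → pairSign a (nxt a) (σ⁻¹ g) ≡ 0ℤ
    pairSign-off-vertex a {g} g≢v = pairSign-consecutive-off (λ g⁻≡a⁺ → g≢v (trans (sym (σ-σ⁻¹ g)) (cong σ g⁻≡a⁺)))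

    chordSign-incident : ∀ a {g₁ g₂} → g₁ ≢ g₂ → g₁ ≡ σ (nxt a) ⊎ g₂ ≡ σ (nxt a) →
                         chordSign a (nxt a) g₁ g₂ ≡ ℤ.+ 2
    chordSign-incident a g₁≢g₂ (inj₁ g₁≡v) =
      cong₂ _+_ (pairSign-at-vertex a g₁≡v) (pairSign-off-vertex a (λ g₂≡v → g₁≢g₂ (trans g₁≡v (sym g₂≡v))))
    chordSign-incident a g₁≢g₂ (inj₂ g₂≡v) =
      cong₂ _+_ (pairSign-off-vertex a (λ g₁≡v → g₁≢g₂ (trans g₁≡v (sym g₂≡v)))) (pairSign-at-vertex a g₂≡v)

    chordSign-away : ∀ a {g₁ g₂} → ¬ (g₁ ≡ σ (nxt a) ⊎ g₂ ≡ σ (nxt a)) → chordSign a (nxt a) g₁ g₂ ≡ 0ℤ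
    chordSign-away a away = cong₂ _+_ (pairSign-off-vertex a (away ∘ inj₁)) (pairSign-off-vertex a (away ∘ inj₂))

  star-cycleEdges : ∀ a → CycleEdgesOf (star G (σ (nxt a))) a (nxt a)
  star-cycleEdges a i<j at = ⇔-trans (∈Eᵇ-star (σ (nxt a)) i<j (cycleEdgeAt-adj at)) (position-incident a at)

  star-chordCondition : ∀ a → ChordCondition (star G (σ (nxt a))) a (nxt a)
  star-chordCondition a {g₁} {g₂} (g₁<g₂ , g∈G , _) with ∈Eᵇ (star G (σ (nxt a))) g₁ g₂ in g∈?
  ... | true  = sym (chordSign-incident a (λ g₁≡g₂ → ℕP.<-irrefl (cong toℕ g₁≡g₂) g₁<g₂)
                                          (Equivalence.to (∈Eᵇ-star (σ (nxt a)) g₁<g₂ g∈G) g∈?))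
  ... | false = sym (chordSign-away a (λ incident →
                  case trans (sym g∈?) (Equivalence.from (∈Eᵇ-star (σ (nxt a)) g₁<g₂ g∈G) incident) of λ ()))

  private
    ⇔⇒≡ : ∀ {b b'} → (b ≡ true ⇔ b' ≡ true) → b ≡ b'
    ⇔⇒≡ {true}  {true}  _ = refl
    ⇔⇒≡ {false} {false} _ = refl
    ⇔⇒≡ {true}  {false} b⇔b' = sym (Equivalence.to b⇔b' refl)
    ⇔⇒≡ {false} {true}  b⇔b' = Equivalence.from b⇔b' refl

    twice-injective : ∀ {b b'} → (if b then ℤ.+ 2 else 0ℤ) ≡ (if b' then ℤ.+ 2 else 0ℤ) → b ≡ b'
    twice-injective {true}  {true}  _  = refl
    twice-injective {false} {false} _  = refl
    twice-injective {true}  {false} ()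
    twice-injective {false} {true}  ()

    twice-values : ∀ b → (if b then ℤ.+ 2 else 0ℤ) ≡ 0ℤ ⊎ (if b then ℤ.+ 2 else 0ℤ) ≡ ℤ.+ 2
    twice-values true  = inj₂ refl
    twice-values false = inj₁ refl

  profile-determines : ∀ {F F' p₁ p₂} → CycleEdgesOf F p₁ p₂ → ChordCondition F p₁ p₂ →
                       CycleEdgesOf F' p₁ p₂ → ChordCondition F' p₁ p₂ → F ≐E[ G ] F'
  profile-determines {F} {F'} edges cond edges' cond' = ∈Eᵇ-agree⇒≐ agree
    where
    agree : ∀ {i j} → toℕ i ℕ.< toℕ j → Adj G i j → ∈Eᵇ F i j ≡ ∈Eᵇ F' i j
    agree {i} {j} i<j ij∈G = case cycleEdge? i j of λ
      { (yes (r , at)) → ⇔⇒≡ (⇔-trans (edges i<j at) (⇔-sym (edges' i<j at)))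
      ; (no ¬ce)       → twice-injective (trans (cond (i<j , ij∈G , ¬ce)) (sym (cond' (i<j , ij∈G , ¬ce)))) }

  chord-pairSigns : ∀ {F a b p q} → ChordCondition F a b → IsChord G C p q →
                    pairSign a b p + pairSign a b q ≡ 0ℤ ⊎ pairSign a b p + pairSign a b q ≡ ℤ.+ 2
  chord-pairSigns {F} {a} {b} {p} {q} cond (σpσq∈G , p≢q⁺ , q≢p⁺) with ℕP.<-cmp (toℕ (σ p)) (toℕ (σ q))
  ... | tri< σp<σq _ _ =
    Data.Sum.map (trans (sym value)) (trans (sym value)) (twice-values (∈Eᵇ F (σ p) (σ q)))
    where
    value = trans (cond (σp<σq , σpσq∈G , positions-chord p≢q⁺ q≢p⁺))
                  (cong₂ (λ x y → pairSign a b x + pairSign a b y) (σ⁻¹-σ p) (σ⁻¹-σ q))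
  ... | tri> _ _ σq<σp =
    Data.Sum.map (trans (sym value)) (trans (sym value)) (twice-values (∈Eᵇ F (σ q) (σ p)))
    where
    value = trans (cond (σq<σp , trans (Graph.sym G (σ q) (σ p)) σpσq∈G , positions-chord q≢p⁺ p≢q⁺))
                  (trans (cong₂ (λ x y → pairSign a b x + pairSign a b y) (σ⁻¹-σ q) (σ⁻¹-σ p))
                         (ℤP.+-comm (pairSign a b q) (pairSign a b p)))
  ... | tri≈ _ σp≡σq _ =
    ⊥-elim (case trans (sym (irrefl G (σ p))) (subst (Adj G (σ p)) (sym (toℕ-injective σp≡σq)) σpσq∈G) of λ ())

  private
    0-or-2⇒≢±4 : ∀ {x s} → x ≡ 0ℤ ⊎ x ≡ ℤ.+ 2 → s ≡ 1ℤ ⊎ s ≡ -1ℤ → x ≢ (s + s) + (s + s)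
    0-or-2⇒≢±4 (inj₁ refl) (inj₁ refl) ()
    0-or-2⇒≢±4 (inj₁ refl) (inj₂ refl) ()
    0-or-2⇒≢±4 (inj₂ refl) (inj₁ refl) ()
    0-or-2⇒≢±4 (inj₂ refl) (inj₂ refl) ()

    0-or-2⇒≢-2 : ∀ {x} → x ≡ 0ℤ ⊎ x ≡ ℤ.+ 2 → x ≢ (-1ℤ + -1ℤ) + 0ℤ
    0-or-2⇒≢-2 (inj₁ refl) ()
    0-or-2⇒≢-2 (inj₂ refl) ()

  disjoint-impossible : ∀ {F a b} → DisjointEdges a b → ChordCondition F a b →
                        ¬ (NonCrossingEvenChord G C a b ⊎ CrossingOddChord G C a b)
  disjoint-impossible {F} {a} {b} (a≢b , _) cond (inj₁ (p , q , chord , dp , _ , dq , _ , p∈P₀ , q∈P₀ , 2∣dp-dq)) =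
    0-or-2⇒≢±4 (chord-pairSigns cond chord) (-1^≡±1 dp) sum≡4s
    where
    sum≡4s : pairSign a b p + pairSign a b q ≡ (-1ℤ ^ dp + -1ℤ ^ dp) + (-1ℤ ^ dp + -1ℤ ^ dp)
    sum≡4s = cong₂ _+_ (pairSign-onP0 n-odd a≢b p∈P₀)
                       (trans (pairSign-onP0 n-odd a≢b q∈P₀) (cong (λ s → s + s) (sym (-1^-cong-parity dp dq 2∣dp-dq))))
  disjoint-impossible {F} {a} {b} (a≢b , _) cond (inj₂ (p , q , chord , (dp , _ , p∈P₀ , 2∤dp , _) , q∉P₀)) =
    0-or-2⇒≢-2 (chord-pairSigns cond chord) sum≡-2
    where
    sum≡-2 : pairSign a b p + pairSign a b q ≡ (-1ℤ + -1ℤ) + 0ℤ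
    sum≡-2 = cong₂ _+_ (trans (pairSign-onP0 n-odd a≢b p∈P₀) (cong (λ s → s + s) (-1^odd≡-1 2∤dp)))
                       (pairSign-offP0 n-odd a≢b q∉P₀)

  private
    nxt≢id : ∀ a → a ≢ nxt a
    nxt≢id a a≡a⁺ = case trans (sym (irrefl G (σ a))) (subst (λ x → Adj G (σ a) (σ x)) (sym a≡a⁺) (cyc a)) of λ ()

  star-∑∑-over-w≡2K : ∀ a → ∑∑-over w (star G (σ (nxt a))) ≡ 2K
  star-∑∑-over-w≡2K a = profile⇒∑∑-over-w≡2K (nxt≢id a) (star-cycleEdges a) (star-chordCondition a)

  consecutive⇒maximal : ∀ {F a} → CycleEdgesOf F a (nxt a) → ChordCondition F a (nxt a) → MaximalStar G F
  consecutive⇒maximal {F} {a} edgesOf cond =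
    star-maximal {u₁ = σ a} {u₂ = σ (nxt (nxt a))}
      (λ σa≡σa⁺⁺ → nxt²≢id n≥3 a (sym (σ-inj σa≡σa⁺⁺)))
      (trans (Graph.sym G (σ (nxt a)) (σ a)) (cyc a)) (cyc (nxt a))
      (profile-determines edgesOf cond (star-cycleEdges a) (star-chordCondition a))

  profile-swap : ∀ {F p₁ p₂} → CycleEdgesOf F p₁ p₂ → ChordCondition F p₁ p₂ →
                 CycleEdgesOf F p₂ p₁ × ChordCondition F p₂ p₁
  profile-swap {p₁ = p₁} {p₂} edgesOf cond =
    (λ i<j at → ⇔-trans (edgesOf i<j at) (mk⇔ Data.Sum.swap Data.Sum.swap)) ,
    λ {g₁} {g₂} chord → trans (cond chord) (cong₂ _+_ (pairSign-comm p₁ p₂ (σ⁻¹ g₁)) (pairSign-comm p₁ p₂ (σ⁻¹ g₂)))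

  module _ (bad : BadCycle) where

    profile⇒maximal : ∀ {F p₁ p₂} → p₁ ≢ p₂ → CycleEdgesOf F p₁ p₂ → ChordCondition F p₁ p₂ → MaximalStar G F
    profile⇒maximal {F} {p₁} {p₂} p₁≢p₂ edgesOf cond with nxt p₁ ≟ p₂ | nxt p₂ ≟ p₁
    ... | yes refl | _        = consecutive⇒maximal edgesOf cond
    ... | no _     | yes refl = uncurry consecutive⇒maximal (profile-swap edgesOf cond)
    ... | no p₁⁺≢p₂ | no p₂⁺≢p₁ = ⊥-elim (disjoint-impossible disjoint cond (bad p₁ p₂ disjoint))
      where
      disjoint : DisjointEdges p₁ p₂
      disjoint = p₁≢p₂ , p₂⁺≢p₁ ∘ sym , p₁⁺≢p₂ , p₁≢p₂ ∘ nxt-injective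

    ∑∑-over-w≡2K⇒maximal : ∀ F → ∑∑-over w F ≡ 2K → MaximalStar G F
    ∑∑-over-w≡2K⇒maximal F weight≡2K =
      let p₁ , p₂ , p₁≢p₂ , edgesOf , cond = ∑∑-over-w≡2K⇒profile F weight≡2K
      in profile⇒maximal p₁≢p₂ edgesOf cond

  private
    M : ℕ
    M = ℕ.pred (K ℕ.* 2)

    1+M≡2K : ℤ.+ suc M ≡ 2K
    1+M≡2K = trans (cong ℤ.+_ (ℕP.suc-pred (K ℕ.* 2) {{ℕ.>-nonZero 0<2K}})) (ℤP.pos-* K 2)
      where
      0<2K : 0 ℕ.< K ℕ.* 2
      0<2K = ℕP.*-mono-< (ℕP.m^n>0 (B ℕ.^ n) {{ℕ.>-nonZero (ℕP.m^n>0 B n)}} n) (s≤s z≤n)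

  open ScaledWeights M

  equistarable : BadCycle → Equistarable G
  equistarable bad =
    noIsolated , φ , (λ i j i<j ij∈G → scaled-pos (w-pos i<j ij∈G)) , λ F → maximal⇒weight≡1 F , weight≡1⇒maximal F
    where
    φ : Fin n → Fin n → Data.Rational.ℚ
    φ i j = scaled (w i j)
    weight≡1⇔ : ∀ F → weight G φ F ≡ Data.Rational.1ℚ ⇔ ∑∑-over w F ≡ 2K
    weight≡1⇔ F = mk⇔ (λ eq → scaled-injective (trans (sym (weight-scaled G w F)) (trans eq (sym one))))
                      (λ eq → trans (weight-scaled G w F) (trans (cong scaled eq) one))
      where one = trans (cong scaled (sym 1+M≡2K)) scaled-1+M
    noIsolated : NoIsolated G
    noIsolated v = σ (nxt (σ⁻¹ v)) , subst (λ u → Adj G u (σ (nxt (σ⁻¹ v)))) (σ-σ⁻¹ v) (cyc (σ⁻¹ v))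
    maximal⇒weight≡1 : ∀ F → MaximalStar G F → weight G φ F ≡ Data.Rational.1ℚ
    maximal⇒weight≡1 F ((v , F≐sv) , _) = Equivalence.from (weight≡1⇔ F)
      (trans (∑∑-over-cong w F≐sv) (subst (λ u → ∑∑-over w (star G u) ≡ 2K) σnxta≡v (star-∑∑-over-w≡2K a)))
      where
      a = prv (σ⁻¹ v)
      σnxta≡v = trans (cong σ (nxt-prv (σ⁻¹ v))) (σ-σ⁻¹ v)
    weight≡1⇒maximal : ∀ F → weight G φ F ≡ Data.Rational.1ℚ → MaximalStar G F
    weight≡1⇒maximal F = ∑∑-over-w≡2K⇒maximal bad F ∘ Equivalence.to (weight≡1⇔ F)

theorem7 : ∀ (n : ℕ) .{{_ : NonZero n}} (G : Graph n) → Bad G → Equistarable G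
theorem7 n G (n-odd , C , bad) = Construction.equistarable C n-odd bad
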